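{- Consider the self-adjusting single-source tree problem on a complete binary tree $T$ with $n$ nodes and a set $E$ of $n$ elements, in the setting described in the context. For every finite request sequence $\sigma$ and every offline algorithm $\textsc{Opt}$ that starts from the same initial placement of elements, the expected total cost of \textsc{Random-Push} on $\sigma$ is at most $16$ times the total cost of $\textsc{Opt}$ on $\sigma$. That is, \textsc{Random-Push} is $16$-competitive.
   Context: Problem: $T$ is a complete binary tree; its root $r_T$ has level $0$ and the level $\ell(v)$ of a node is its distance from the root. There is a set $E$ of $n$ elements, and at all times each node holds exactly one element ($\mathrm{nd}(e)$ is the node holding $e$, $\mathrm{el}(v)$ the element at $v$; $\ell(e)=\ell(\mathrm{nd}(e))$). Requests $\sigma=\sigma^1,\sigma^2,\dots$ are elements of $E$, revealed online. Serving a request to $e$ costs $\ell(e)+1$ (access cost); in addition, any swap of the elements at two adjacent nodes (a node and its parent) costs $1$. The total cost of an algorithm is the sum of all access costs and swap costs. The offline algorithm $\textsc{Opt}$ knows the whole sequence and may perform arbitrary swaps of adjacent elements at any time at unit cost each. Augmented push-down $\mathrm{PD}(u,v)$ for two nodes $u,v$ on the same level $d$: let $r_T=v_0,v_1,\dots,v_d=v$ be the root-to-$v$ path; consider the cycle of nodes $v_0\to v_1\to\dots\to v_d\to u\to v_0$ and move each element on a node of this cycle to the next node of the cycle. It is implemented by adjacent swaps as follows: if $u=v$, the element at $v$ is swapped up to the root; otherwise the element $\mathrm{el}(v)$ is swapped up along the path to the root, then swapped down along the root-to-$u$ path to $u$, and finally the element originally at $u$ (now at the parent of $u$) is swapped up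 to the root. The algorithm's cost for a request is its access cost plus the number of these swaps. \textsc{Random-Push}: upon a request to element $e^*$ at level $d^*$, choose a node $v$ uniformly at random among all nodes of level $d^*$ (including $\mathrm{nd}(e^*)$), independently of previous choices, and execute $\mathrm{PD}(\mathrm{nd}(e^*),v)$. -}

module Defs where

open import Data.Nat as ℕ using (ℕ; zero; suc; _∸_; _<?_; _≟_)
open import Data.Nat.DivMod using (_/_)
open import Data.Fin as Fin using (Fin; toℕ; fromℕ<)
open import Data.Fin.Permutation using (Permutation′; transpose; _∘ₚ_; _⟨$⟩ʳ_; _⟨$⟩ˡ_)
open import Data.List using (List; []; _∷_; _++_; reverse; length; map; foldr; upTo)
open import Data.Vec using (Vec; []; _∷_)
open import Data.Product using (Σ-syntax; proj₁)
open import Data.Integer using (+_)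
open import Data.Rational as ℚ using (ℚ; 0ℚ; 1ℚ; ½)
open import Relation.Nullary using (yes; no; ¬_)
open import Relation.Binary.PropositionalEquality using (_≡_)

-- The complete binary tree of height h, nodes in heap order.
-- Node k (0 ≤ k < size h) ; root = 0 ; parent of k ≥ 1 is (k ∸ 1) / 2.
-- size h = 2^(h+1) - 1 (all levels 0..h full).

size : ℕ → ℕ
size zero    = 1
size (suc h) = suc (2 ℕ.* size h)

-- parent of a heap index (only used for k ≥ 1)
parent : ℕ → ℕ
parent k = (k ∸ 1) / 2

-- path from node k up to (but excluding) the root: k , parent k , … ,
-- the level-1 ancestor of k.  (Fuel k suffices since parent k < k.)
upPathF : ℕ → ℕ → List ℕ
upPathF zero     k = []
upPathF (suc f) zero = []
upPathF (suc f) (suc k) = suc k ∷ upPathF f (parent (suc k))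

upPath : ℕ → List ℕ
upPath k = upPathF k k

level : ℕ → ℕ
level k = length (upPath k)

root : (h : ℕ) → Fin (size h)
root zero    = Fin.zero
root (suc h) = Fin.zero

-- convert a heap index to a node of the tree (indices used are always < size h;
-- out-of-range indices are mapped to the root and never occur)
node : (h : ℕ) → ℕ → Fin (size h)
node h k with k <? size h
... | yes k<n = fromℕ< k<n
... | no  _   = root h

-- Elements E = Fin (size h) (n elements, n = number of nodes).
-- A placement: bijection nodes → elements.
--   el π v = π ⟨$⟩ʳ v    (element at node v)
--   nd π e = π ⟨$⟩ˡ e    (node holding element e)

Config : ℕ → Set
Config h = Permutation′ (size h)

el : {h : ℕ} → Config h → Fin (size h) → Fin (size h)
el π v = π ⟨$⟩ʳ v

nd : {h : ℕ} → Config h → Fin (size h) → Fin (size h)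
nd π e = π ⟨$⟩ˡ e

levelOf : {h : ℕ} → Config h → Fin (size h) → ℕ
levelOf π e = level (toℕ (nd π e))

swapUp : (h : ℕ) → Config h → ℕ → Config h
swapUp h π c = transpose (node h c) (node h (parent c)) ∘ₚ π

applySwaps : (h : ℕ) → Config h → List ℕ → Config h
applySwaps h π []       = π
applySwaps h π (c ∷ cs) = applySwaps h (swapUp h π c) cs

pdSwaps : ℕ → ℕ → List ℕ
pdSwaps u v with u ≟ v
... | yes _ = upPath v
... | no  _ = upPath v ++ reverse (upPath u) ++ upPath (parent u)

ℕtoℚ : ℕ → ℚ
ℕtoℚ k = (+ k) ℚ./ 1

halfPow : ℕ → ℚ
halfPow zero    = 1ℚ
halfPow (suc d) = ½ ℚ.* halfPow d

sumℚ : List ℚ → ℚ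
sumℚ = foldr ℚ._+_ 0ℚ

-- nodes of level d are the heap indices (2^d ∸ 1) + j, 0 ≤ j < 2^d;
-- each is chosen with probability 1/2^d.
expCostRP : (h : ℕ) → Config h → List (Fin (size h)) → ℚ
expCostRP h π []        = 0ℚ
expCostRP h π (e ∷ σ) =
  halfPow d ℚ.* sumℚ (map branch (upTo (2 ℕ.^ d)))
  where
    d : ℕ
    d = levelOf π e
    u : ℕ
    u = toℕ (nd π e)
    branch : ℕ → ℚ
    branch j =
      let v  = ((2 ℕ.^ d) ∸ 1) ℕ.+ j
          sw = pdSwaps u v
      in ℕtoℚ (suc d ℕ.+ length sw) ℚ.+ expCostRP h (applySwaps h π sw) σ

-- Offline algorithms: before serving each request, an arbitrary finite
-- sequence of adjacent swaps (a swap is named by its child node c ≠ root).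

Swap : ℕ → Set
Swap h = Σ[ c ∈ Fin (size h) ] ¬ (toℕ c ≡ 0)

OfflineAlg : {h : ℕ} → List (Fin (size h)) → Set
OfflineAlg {h} σ = Vec (List (Swap h)) (length σ)

costOpt : (h : ℕ) → Config h → (σ : List (Fin (size h))) → OfflineAlg {h} σ → ℕ
costOpt h π []      []         = 0
costOpt h π (e ∷ σ) (ss ∷ sch) =
  let π′ = applySwaps h π (map (λ s → toℕ (proj₁ s)) ss)
  in length ss ℕ.+ suc (levelOf π′ e) ℕ.+ costOpt h π′ σ sch

-- Let Φ be the sum over all elements e of 4 · max(0, ℓ(e) − 4 ℓ*(e)),
-- where ℓ and ℓ* are the levels of e in the placements of Random-Push and of Opt.
-- One swap of Opt raises Φ by at most 16. Serving a request to an element at level d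
-- with ℓ* = L, PD(u, v) moves it to the root, releasing 4 · max(0, d − 4L), and moves
-- every other element on the path to v one level down, which raises Φ by at most 4
-- per ancestor x of v whose element has ℓ* ≤ level x / 4. Distinct nodes hold distinct
-- elements, so level i has at most size ⌊i/4⌋ = 2^(⌊i/4⌋+1) − 1 such nodes, and for
-- uniformly random v the expected number of these ancestors is at most 15/4. The
-- amortised cost of a request is therefore at most (1 + 4d) + 15 − 4 · max(0, d − 4L)
-- ≤ 16 (L + 1); Φ starts at 0 and stays nonnegative.

module Submission where

open import Defs

module Amortised where

  open import Data.Nat using (ℕ; zero; suc; _+_; _*_; _∸_; _^_; _≤_; _<_; z≤n; s≤s; s≤s⁻¹; _≟_; _≤?_; _<?_; >-nonZero)
  open import Data.Nat.Properties
  open import Algebra.Properties.CommutativeSemigroup +-commutativeSemigroup using (x∙yz≈y∙xz; xy∙z≈xz∙y)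
  open import Data.Nat.DivMod using (_/_; _%_; m/n≤m; m≡m%n+[m/n]*n; m%n<n; m*n/n≡m; +-distrib-/-∣ˡ; m<n*o⇒m/o<n)
  open import Data.Nat.Divisibility using (divides)
  open import Data.Nat.Induction using (<-rec)
  open import Data.Nat.Tactic.RingSolver using (solve-∀)
  open import Data.Fin as Fin using (Fin; toℕ)
  open import Data.Fin.Properties using (toℕ-fromℕ<; toℕ-injective; toℕ<n)
  import Data.Fin.Permutation.Components as PC
  open import Data.Fin.Permutation using (inverseʳ; inverseˡ)
  open import Data.List using (List; []; _∷_; _++_; reverse; length; [_]; map)
  open import Data.List.Properties using (unfold-reverse; length-++; length-reverse; length-map)
  open import Data.List.Membership.Propositional using (_∈_; _∉_)
  open import Data.List.Membership.DecPropositional _≟_ using (_∈?_)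
  open import Data.List.Relation.Unary.Any using (here; there)
  open import Data.List.Relation.Unary.Any.Properties using (reverse⁻)
  open import Data.List.Relation.Unary.All using (All; []; _∷_; tabulate)
  open import Data.List.Relation.Unary.All.Properties using (++⁺; ¬Any⇒All¬; All¬⇒¬Any)
  open import Data.List.Relation.Unary.Unique.Propositional using (Unique; []; _∷_)
  open import Data.Product using (_×_; _,_; proj₁; proj₂)
  open import Data.Sum using (_⊎_; inj₁; inj₂; [_,_]′)
  open import Data.Empty using (⊥-elim)
  open import Relation.Nullary using (Dec; yes; no; ¬_)
  open import Relation.Nullary.Decidable using (_×-dec_; ¬?)
  open import Relation.Binary.PropositionalEquality hiding ([_])

  -- Heap-ordered indices

  parent≤ : ∀ k → parent k ≤ k
  parent≤ k = ≤-trans (m/n≤m (k ∸ 1) 2) (m∸n≤m k 1)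

  parent-suc< : ∀ k → parent (suc k) < suc k
  parent-suc< k = s≤s (m/n≤m k 2)

  suc≤2*parent+2 : ∀ k → suc k ≤ 2 * parent (suc k) + 2
  suc≤2*parent+2 k = begin
    suc k                      ≡⟨ cong suc (m≡m%n+[m/n]*n k 2) ⟩
    suc (k % 2 + (k / 2) * 2)  ≤⟨ s≤s (+-monoˡ-≤ ((k / 2) * 2) (s≤s⁻¹ (m%n<n k 2))) ⟩
    suc (1 + (k / 2) * 2)      ≡⟨ ring (k / 2) ⟩
    2 * (k / 2) + 2            ∎
    where
    open ≤-Reasoning
    ring : ∀ q → suc (1 + q * 2) ≡ 2 * q + 2
    ring = solve-∀

  [2*m+n]/2≡m+n/2 : ∀ m n → (2 * m + n) / 2 ≡ m + n / 2
  [2*m+n]/2≡m+n/2 m n = trans (+-distrib-/-∣ˡ n (divides m (*-comm 2 m)))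
                              (cong (_+ n / 2) (trans (cong (_/ 2) (*-comm 2 m)) (m*n/n≡m m 2)))

  2*m/2≡m : ∀ m → (2 * m) / 2 ≡ m
  2*m/2≡m m = begin
    (2 * m) / 2      ≡⟨ cong (_/ 2) (+-identityʳ (2 * m)) ⟨
    (2 * m + 0) / 2  ≡⟨ [2*m+n]/2≡m+n/2 m 0 ⟩
    m + 0            ≡⟨ +-identityʳ m ⟩
    m                ∎
    where open ≡-Reasoning

  [1+2*m]/2≡m : ∀ m → suc (2 * m) / 2 ≡ m
  [1+2*m]/2≡m m = begin
    suc (2 * m) / 2  ≡⟨ cong (_/ 2) (+-comm 1 (2 * m)) ⟩
    (2 * m + 1) / 2  ≡⟨ [2*m+n]/2≡m+n/2 m 1 ⟩
    m + 0            ≡⟨ +-identityʳ m ⟩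
    m                ∎
    where open ≡-Reasoning

  ancestor-induction : ∀ {ℓ} (P : ℕ → Set ℓ) → P 0 → (∀ k → P (parent (suc k)) → P (suc k)) → ∀ v → P v
  ancestor-induction P base step = <-rec P λ
    { zero    _   → base
    ; (suc k) rec → step k (rec (parent-suc< k))
    }

  upPathF-fuel-irrelevant : ∀ f g k → k ≤ f → k ≤ g → upPathF f k ≡ upPathF g k
  upPathF-fuel-irrelevant zero    zero    zero    _         _         = refl
  upPathF-fuel-irrelevant zero    (suc g) zero    _         _         = refl
  upPathF-fuel-irrelevant (suc f) zero    zero    _         _         = refl
  upPathF-fuel-irrelevant (suc f) (suc g) zero    _         _         = refl
  upPathF-fuel-irrelevant (suc f) (suc g) (suc k) (s≤s k≤f) (s≤s k≤g) =
    cong (suc k ∷_) (upPathF-fuel-irrelevant f g (parent (suc k)) (≤-trans (m/n≤m k 2) k≤f) (≤-trans (m/n≤m k 2) k≤g))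

  upPath-suc : ∀ k → upPath (suc k) ≡ suc k ∷ upPath (parent (suc k))
  upPath-suc k = cong (suc k ∷_) (upPathF-fuel-irrelevant k (parent (suc k)) (parent (suc k)) (m/n≤m k 2) ≤-refl)

  level-suc : ∀ k → level (suc k) ≡ suc (level (parent (suc k)))
  level-suc k = cong length (upPath-suc k)

  level-parent≤ : ∀ k → level (parent k) ≤ level k
  level-parent≤ zero    = ≤-refl
  level-parent≤ (suc k) = ≤-trans (n≤1+n _) (≤-reflexive (sym (level-suc k)))

  level≤1+level-parent : ∀ k → level k ≤ suc (level (parent k))
  level≤1+level-parent zero    = z≤n
  level≤1+level-parent (suc k) = ≤-reflexive (level-suc k)

  level≡0⇒≡0 : ∀ k → level k ≡ 0 → k ≡ 0
  level≡0⇒≡0 zero    _ = refl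
  level≡0⇒≡0 (suc k) e with trans (sym (level-suc k)) e
  ... | ()

  ∈upPath⇒ : ∀ k {x} → x ∈ upPath k → 0 < x × x ≤ k
  ∈upPath⇒ = ancestor-induction (λ k → ∀ {x} → x ∈ upPath k → 0 < x × x ≤ k) (λ ()) step
    where
    step : ∀ k → (∀ {x} → x ∈ upPath (parent (suc k)) → 0 < x × x ≤ parent (suc k)) →
           ∀ {x} → x ∈ upPath (suc k) → 0 < x × x ≤ suc k
    step k ih {x} x∈ with subst (x ∈_) (upPath-suc k) x∈
    ... | here refl = s≤s z≤n , ≤-refl
    ... | there x∈′ = proj₁ (ih x∈′) , ≤-trans (proj₂ (ih x∈′)) (parent≤ (suc k))

  0∉upPath : ∀ k → 0 ∉ upPath k
  0∉upPath k 0∈ with proj₁ (∈upPath⇒ k 0∈)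
  ... | ()

  suc∉upPath-parent : ∀ k → suc k ∉ upPath (parent (suc k))
  suc∉upPath-parent k k∈ = <-irrefl refl (≤-trans (s≤s (proj₂ (∈upPath⇒ _ k∈))) (parent-suc< k))

  ∈upPath-self : ∀ k → 0 < k → k ∈ upPath k
  ∈upPath-self (suc k) _ = subst (suc k ∈_) (sym (upPath-suc k)) (here refl)

  ∈upPath⇒≡⊎level< : ∀ v {x} → x ∈ upPath v → x ≡ v ⊎ level x < level v
  ∈upPath⇒≡⊎level< = ancestor-induction (λ v → ∀ {x} → x ∈ upPath v → x ≡ v ⊎ level x < level v) (λ ()) step
    where
    step : ∀ k → (∀ {x} → x ∈ upPath (parent (suc k)) → x ≡ parent (suc k) ⊎ level x < level (parent (suc k))) →
           ∀ {x} → x ∈ upPath (suc k) → x ≡ suc k ⊎ level x < level (suc k)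
    step k ih {x} x∈ rewrite level-suc k with subst (x ∈_) (upPath-suc k) x∈
    ... | here refl = inj₁ refl
    ... | there x∈′ with ih x∈′
    ...   | inj₁ refl = inj₂ ≤-refl
    ...   | inj₂ lt   = inj₂ (m<n⇒m<1+n lt)

  size-pos : ∀ h → 0 < size h
  size-pos zero    = s≤s z≤n
  size-pos (suc h) = s≤s z≤n

  1+size≡2^[1+h] : ∀ h → suc (size h) ≡ 2 ^ suc h
  1+size≡2^[1+h] zero    = refl
  1+size≡2^[1+h] (suc h) = trans (ring (size h)) (cong (2 *_) (1+size≡2^[1+h] h))
    where
    ring : ∀ s → suc (suc (2 * s)) ≡ 2 * suc s
    ring = solve-∀

  size-mono : ∀ {h h′} → h ≤ h′ → size h ≤ size h′
  size-mono {zero}  {zero}   _         = ≤-refl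
  size-mono {zero}  {suc h′} _         = s≤s z≤n
  size-mono {suc h} {suc h′} (s≤s h≤h′) = s≤s (*-monoʳ-≤ 2 (size-mono h≤h′))

  level≤⇒<size : ∀ k {h} → level k ≤ h → k < size h
  level≤⇒<size = ancestor-induction (λ k → ∀ {h} → level k ≤ h → k < size h) (λ {h} _ → size-pos h) step
    where
    step : ∀ k → (∀ {h} → level (parent (suc k)) ≤ h → parent (suc k) < size h) →
           ∀ {h} → level (suc k) ≤ h → suc k < size h
    step k ih {h} lv≤h rewrite level-suc k with h | lv≤h
    ... | suc h′ | s≤s lp≤h′ = s≤s (begin
      suc k                      ≤⟨ suc≤2*parent+2 k ⟩
      2 * parent (suc k) + 2     ≡⟨ ring (parent (suc k)) ⟩
      2 * suc (parent (suc k))   ≤⟨ *-monoʳ-≤ 2 (ih lp≤h′) ⟩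
      2 * size h′                ∎)
      where
      open ≤-Reasoning
      ring : ∀ p → 2 * p + 2 ≡ 2 * suc p
      ring = solve-∀

  <size⇒level≤ : ∀ k {h} → k < size h → level k ≤ h
  <size⇒level≤ = ancestor-induction (λ k → ∀ {h} → k < size h → level k ≤ h) (λ _ → z≤n) step
    where
    step : ∀ k → (∀ {h} → parent (suc k) < size h → level (parent (suc k)) ≤ h) →
           ∀ {h} → suc k < size h → level (suc k) ≤ h
    step k ih {zero}   (s≤s ())
    step k ih {suc h′} (s≤s k<2s) rewrite level-suc k =
      s≤s (ih (m<n*o⇒m/o<n (subst (k <_) (*-comm 2 (size h′)) k<2s)))

  levelNode : ℕ → ℕ → ℕ
  levelNode d j = (2 ^ d ∸ 1) + j

  2^d≡1+[2^d∸1] : ∀ d → 2 ^ d ≡ suc (2 ^ d ∸ 1)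
  2^d≡1+[2^d∸1] d = sym (suc-pred (2 ^ d) {{>-nonZero (m^n>0 2 d)}})

  levelNode-suc : ∀ d j → levelNode (suc d) j ≡ suc (2 * (2 ^ d ∸ 1) + j)
  levelNode-suc d j = cong (_+ j) (begin
    2 * 2 ^ d ∸ 1              ≡⟨ cong (λ z → 2 * z ∸ 1) (2^d≡1+[2^d∸1] d) ⟩
    2 * suc (2 ^ d ∸ 1) ∸ 1    ≡⟨ cong (_∸ 1) (ring (2 ^ d ∸ 1)) ⟩
    suc (2 * (2 ^ d ∸ 1))      ∎)
    where
    open ≡-Reasoning
    ring : ∀ t → 2 * suc t ≡ suc (suc (2 * t))
    ring = solve-∀

  parent-levelNode : ∀ d j → parent (levelNode (suc d) j) ≡ levelNode d (j / 2)
  parent-levelNode d j rewrite levelNode-suc d j = [2*m+n]/2≡m+n/2 (2 ^ d ∸ 1) j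

  j<2^[1+d]⇒j/2<2^d : ∀ d j → j < 2 ^ suc d → j / 2 < 2 ^ d
  j<2^[1+d]⇒j/2<2^d d j lt = m<n*o⇒m/o<n (subst (j <_) (*-comm 2 (2 ^ d)) lt)

  level-levelNode : ∀ d j → j < 2 ^ d → level (levelNode d j) ≡ d
  level-levelNode zero    zero    _        = refl
  level-levelNode zero    (suc j) (s≤s ())
  level-levelNode (suc d) j       lt       = begin
    level (levelNode (suc d) j)                    ≡⟨ cong level (levelNode-suc d j) ⟩
    level (suc (2 * (2 ^ d ∸ 1) + j))              ≡⟨ level-suc (2 * (2 ^ d ∸ 1) + j) ⟩
    suc (level (parent (suc (2 * (2 ^ d ∸ 1) + j)))) ≡⟨ cong (λ z → suc (level (parent z))) (levelNode-suc d j) ⟨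
    suc (level (parent (levelNode (suc d) j)))     ≡⟨ cong (λ z → suc (level z)) (parent-levelNode d j) ⟩
    suc (level (levelNode d (j / 2)))              ≡⟨ cong suc (level-levelNode d (j / 2) (j<2^[1+d]⇒j/2<2^d d j lt)) ⟩
    suc d                                          ∎
    where open ≡-Reasoning

  levelNode<size : ∀ {h d j} → d ≤ h → j < 2 ^ d → levelNode d j < size h
  levelNode<size {h} {d} {j} d≤h lt = <-≤-trans levelNode<size-d (size-mono d≤h)
    where
    levelNode<size-d : levelNode d j < size d
    levelNode<size-d = +-cancelˡ-< 1 _ _ (begin-strict
      suc (levelNode d j)  ≡⟨ cong (_+ j) (2^d≡1+[2^d∸1] d) ⟨
      2 ^ d + j            <⟨ +-monoʳ-< (2 ^ d) lt ⟩
      2 ^ d + 2 ^ d        ≡⟨ cong (2 ^ d +_) (+-identityʳ (2 ^ d)) ⟨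
      2 ^ suc d            ≡⟨ 1+size≡2^[1+h] d ⟨
      suc (size d)         ∎)
      where open ≤-Reasoning

  -- Swap sequences as maps on nodes

  transposeℕ : ℕ → ℕ → ℕ → ℕ
  transposeℕ a b w with w ≟ a
  ... | yes _ = b
  ... | no  _ with w ≟ b
  ...   | yes _ = a
  ...   | no  _ = w

  transposeℕ-a : ∀ a b → transposeℕ a b a ≡ b
  transposeℕ-a a b with a ≟ a
  ... | yes _ = refl
  ... | no a≢a = ⊥-elim (a≢a refl)

  transposeℕ-b : ∀ a b → transposeℕ a b b ≡ a
  transposeℕ-b a b with b ≟ a
  ... | yes b≡a = b≡a
  ... | no _ with b ≟ b
  ...   | yes _ = refl
  ...   | no b≢b = ⊥-elim (b≢b refl)

  transposeℕ-other : ∀ a b {w} → ¬ w ≡ a → ¬ w ≡ b → transposeℕ a b w ≡ w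
  transposeℕ-other a b {w} w≢a w≢b with w ≟ a
  ... | yes w≡a = ⊥-elim (w≢a w≡a)
  ... | no _ with w ≟ b
  ...   | yes w≡b = ⊥-elim (w≢b w≡b)
  ...   | no _ = refl

  transposeℕ-< : ∀ {K} a b w → a < K → b < K → w < K → transposeℕ a b w < K
  transposeℕ-< a b w a<K b<K w<K with w ≟ a
  ... | yes _ = b<K
  ... | no  _ with w ≟ b
  ...   | yes _ = a<K
  ...   | no  _ = w<K

  -- After performing the child/parent swaps cs, node w holds the element that
  -- was at node origin cs w before.
  origin : List ℕ → ℕ → ℕ
  origin []       w = w
  origin (c ∷ cs) w = transposeℕ c (parent c) (origin cs w)

  origin-++ : ∀ xs ys w → origin (xs ++ ys) w ≡ origin xs (origin ys w)
  origin-++ []       ys w = refl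
  origin-++ (x ∷ xs) ys w = cong (transposeℕ x (parent x)) (origin-++ xs ys w)

  origin-< : ∀ {K} cs w → All (_< K) cs → w < K → origin cs w < K
  origin-< []       w []           w<K = w<K
  origin-< (c ∷ cs) w (c<K ∷ cs<K) w<K =
    transposeℕ-< c (parent c) _ c<K (≤-<-trans (parent≤ c) c<K) (origin-< cs w cs<K w<K)

  upPath-< : ∀ {K} v → v < K → All (_< K) (upPath v)
  upPath-< v v<K = tabulate (λ x∈ → ≤-<-trans (proj₂ (∈upPath⇒ v x∈)) v<K)

  parent<∈upPath : ∀ k {x} → x ∈ upPath k → parent x < x
  parent<∈upPath k {x} x∈ with x | proj₁ (∈upPath⇒ k x∈)
  ... | suc x′ | _ = parent-suc< x′

  ∈upPath-parent : ∀ k → ¬ parent (suc k) ≡ 0 → parent (suc k) ∈ upPath (suc k)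
  ∈upPath-parent k p≢0 = subst (parent (suc k) ∈_) (sym (upPath-suc k)) (there (∈upPath-self _ (n≢0⇒n>0 p≢0)))

  transposeℕ-below : ∀ k {y} → y < parent (suc k) → transposeℕ (suc k) (parent (suc k)) y ≡ y
  transposeℕ-below k y<p =
    transposeℕ-other (suc k) (parent (suc k)) (<⇒≢ (<-trans y<p (parent-suc< k))) (<⇒≢ y<p)

  ∉upPath-suc : ∀ k {x} → x ∉ upPath (suc k) → ¬ x ≡ suc k × x ∉ upPath (parent (suc k))
  ∉upPath-suc k {x} x∉ = (λ { refl → x∉ (subst (x ∈_) (sym (upPath-suc k)) (here refl)) })
                       , (λ x∈ → x∉ (subst (x ∈_) (sym (upPath-suc k)) (there x∈)))

  ≢parent-of-∉upPath : ∀ k {x} → x ∉ upPath (suc k) → ¬ x ≡ 0 → ¬ x ≡ parent (suc k)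
  ≢parent-of-∉upPath k x∉ x≢0 refl = x∉ (∈upPath-parent k x≢0)

  origin-upPath-suc : ∀ k w → origin (upPath (suc k)) w ≡ transposeℕ (suc k) (parent (suc k)) (origin (upPath (parent (suc k))) w)
  origin-upPath-suc k w = cong (λ cs → origin cs w) (upPath-suc k)

  origin-upPath-∉ : ∀ v {x} → x ∉ upPath v → ¬ x ≡ 0 → origin (upPath v) x ≡ x
  origin-upPath-∉ = ancestor-induction _ (λ _ _ → refl) step
    where
    step : ∀ k → (∀ {x} → x ∉ upPath (parent (suc k)) → ¬ x ≡ 0 → origin (upPath (parent (suc k))) x ≡ x) →
           ∀ {x} → x ∉ upPath (suc k) → ¬ x ≡ 0 → origin (upPath (suc k)) x ≡ x
    step k ih {x} x∉ x≢0 =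
      trans (origin-upPath-suc k x)
      (trans (cong (transposeℕ (suc k) (parent (suc k))) (ih (proj₂ x∉′) x≢0))
            (transposeℕ-other (suc k) (parent (suc k)) (proj₁ x∉′) (≢parent-of-∉upPath k x∉ x≢0)))
      where x∉′ = ∉upPath-suc k x∉

  origin-upPath-root : ∀ v → origin (upPath v) 0 ≡ v
  origin-upPath-root = ancestor-induction _ refl step
    where
    step : ∀ k → origin (upPath (parent (suc k))) 0 ≡ parent (suc k) → origin (upPath (suc k)) 0 ≡ suc k
    step k ih rewrite origin-upPath-suc k 0 | ih = transposeℕ-b (suc k) (parent (suc k))

  origin-upPath-∈ : ∀ v {x} → x ∈ upPath v → origin (upPath v) x ≡ parent x
  origin-upPath-∈ = ancestor-induction _ (λ ()) step
    where
    step : ∀ k → (∀ {x} → x ∈ upPath (parent (suc k)) → origin (upPath (parent (suc k))) x ≡ parent x) →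
           ∀ {x} → x ∈ upPath (suc k) → origin (upPath (suc k)) x ≡ parent x
    step k ih {x} x∈ with subst (x ∈_) (upPath-suc k) x∈
    ... | here refl rewrite origin-upPath-suc k (suc k) | origin-upPath-∉ (parent (suc k)) (suc∉upPath-parent k) (λ ()) =
      transposeℕ-a (suc k) (parent (suc k))
    ... | there x∈′ rewrite origin-upPath-suc k x | ih x∈′ =
      transposeℕ-below k (<-≤-trans (parent<∈upPath _ x∈′) (proj₂ (∈upPath⇒ _ x∈′)))

  downPath : ℕ → List ℕ
  downPath u = reverse (upPath u)

  origin-downPath-suc : ∀ k w → origin (downPath (suc k)) w ≡ origin (downPath (parent (suc k))) (transposeℕ (suc k) (parent (suc k)) w)
  origin-downPath-suc k w = begin
    origin (downPath (suc k)) w                                   ≡⟨ cong (λ cs → origin (reverse cs) w) (upPath-suc k) ⟩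
    origin (reverse (suc k ∷ upPath (parent (suc k)))) w          ≡⟨ cong (λ cs → origin cs w) (unfold-reverse (suc k) (upPath (parent (suc k)))) ⟩
    origin (downPath (parent (suc k)) ++ [ suc k ]) w             ≡⟨ origin-++ (downPath (parent (suc k))) [ suc k ] w ⟩
    origin (downPath (parent (suc k))) (transposeℕ (suc k) (parent (suc k)) w) ∎
    where open ≡-Reasoning

  origin-downPath-∉ : ∀ u {x} → x ∉ upPath u → ¬ x ≡ 0 → origin (downPath u) x ≡ x
  origin-downPath-∉ = ancestor-induction _ (λ _ _ → refl) step
    where
    step : ∀ k → (∀ {x} → x ∉ upPath (parent (suc k)) → ¬ x ≡ 0 → origin (downPath (parent (suc k))) x ≡ x) →
           ∀ {x} → x ∉ upPath (suc k) → ¬ x ≡ 0 → origin (downPath (suc k)) x ≡ x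
    step k ih {x} x∉ x≢0 rewrite origin-downPath-suc k x
      | transposeℕ-other (suc k) (parent (suc k)) (proj₁ (∉upPath-suc k x∉)) (≢parent-of-∉upPath k x∉ x≢0) =
      ih (proj₂ (∉upPath-suc k x∉)) x≢0

  origin-downPath-self : ∀ u → origin (downPath u) u ≡ 0
  origin-downPath-self = ancestor-induction _ refl step
    where
    step : ∀ k → origin (downPath (parent (suc k))) (parent (suc k)) ≡ 0 → origin (downPath (suc k)) (suc k) ≡ 0
    step k ih rewrite origin-downPath-suc k (suc k) | transposeℕ-a (suc k) (parent (suc k)) = ih

  origin-downPath-parent : ∀ u {x} → x ∈ upPath u → origin (downPath u) (parent x) ≡ x
  origin-downPath-parent = ancestor-induction _ (λ ()) step
    where
    step : ∀ k → (∀ {x} → x ∈ upPath (parent (suc k)) → origin (downPath (parent (suc k))) (parent x) ≡ x) →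
           ∀ {x} → x ∈ upPath (suc k) → origin (downPath (suc k)) (parent x) ≡ x
    step k ih {x} x∈ with subst (x ∈_) (upPath-suc k) x∈
    ... | here refl rewrite origin-downPath-suc k (parent (suc k)) | transposeℕ-b (suc k) (parent (suc k)) =
      origin-downPath-∉ (parent (suc k)) (suc∉upPath-parent k) (λ ())
    ... | there x∈′ rewrite origin-downPath-suc k (parent x)
      | transposeℕ-below k (<-≤-trans (parent<∈upPath _ x∈′) (proj₂ (∈upPath⇒ _ x∈′))) = ih x∈′

  -- Going down the path to u and back up to its parent exchanges the root and u.
  rootExchange : ℕ → List ℕ
  rootExchange u = downPath u ++ upPath (parent u)

  origin-rootExchange : ∀ u w → origin (rootExchange u) w ≡ origin (downPath u) (origin (upPath (parent u)) w)
  origin-rootExchange u w = origin-++ (downPath u) (upPath (parent u)) w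

  origin-rootExchange-self : ∀ u → 0 < u → origin (rootExchange u) u ≡ 0
  origin-rootExchange-self (suc k) _ rewrite origin-rootExchange (suc k) (suc k)
    | origin-upPath-∉ (parent (suc k)) (suc∉upPath-parent k) (λ ()) = origin-downPath-self (suc k)

  origin-rootExchange-other : ∀ u → 0 < u → ∀ {x} → ¬ x ≡ 0 → ¬ x ≡ u → origin (rootExchange u) x ≡ x
  origin-rootExchange-other (suc k) _ {x} x≢0 x≢u rewrite origin-rootExchange (suc k) x with x ∈? upPath (parent (suc k))
  ... | yes x∈ rewrite origin-upPath-∈ _ x∈ =
    origin-downPath-parent (suc k) (subst (x ∈_) (sym (upPath-suc k)) (there x∈))
  ... | no x∉ rewrite origin-upPath-∉ _ x∉ x≢0 =
    origin-downPath-∉ (suc k) (λ x∈ → [ x≢u , x∉ ]′ (split (subst (x ∈_) (upPath-suc k) x∈))) x≢0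
    where
    split : x ∈ suc k ∷ upPath (parent (suc k)) → x ≡ suc k ⊎ x ∈ upPath (parent (suc k))
    split (here x≡u)  = inj₁ x≡u
    split (there x∈) = inj₂ x∈

  pdSwaps-≡ : ∀ u → pdSwaps u u ≡ upPath u
  pdSwaps-≡ u with u ≟ u
  ... | yes _   = refl
  ... | no u≢u = ⊥-elim (u≢u refl)

  pdSwaps-≢ : ∀ {u v} → ¬ u ≡ v → pdSwaps u v ≡ upPath v ++ rootExchange u
  pdSwaps-≢ {u} {v} u≢v with u ≟ v
  ... | yes u≡v = ⊥-elim (u≢v u≡v)
  ... | no  _   = refl

  pdSwaps-< : ∀ {K} u v → u < K → v < K → All (_< K) (pdSwaps u v)
  pdSwaps-< u v u<K v<K with u ≟ v
  ... | yes _ = upPath-< v v<K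
  ... | no  _ = ++⁺ (upPath-< v v<K)
                    (++⁺ (tabulate (λ x∈ → ≤-<-trans (proj₂ (∈upPath⇒ u (reverse⁻ x∈))) u<K))
                         (upPath-< (parent u) (≤-<-trans (parent≤ u) u<K)))

  length-pdSwaps : ∀ u v → level u ≡ level v → length (pdSwaps u v) ≤ 3 * level u
  length-pdSwaps u v same with u ≟ v
  ... | yes refl = m≤m+n (level u) _
  ... | no  _    = begin
    length (upPath v ++ reverse (upPath u) ++ upPath (parent u))  ≡⟨ length-++ (upPath v) ⟩
    level v + length (reverse (upPath u) ++ upPath (parent u))    ≡⟨ cong (level v +_) (length-++ (reverse (upPath u))) ⟩
    level v + (length (reverse (upPath u)) + level (parent u))    ≡⟨ cong (λ z → level v + (z + level (parent u))) (length-reverse (upPath u)) ⟩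
    level v + (level u + level (parent u))                        ≤⟨ +-monoʳ-≤ (level v) (+-monoʳ-≤ (level u) (level-parent≤ u)) ⟩
    level v + (level u + level u)                                 ≡⟨ cong (λ z → z + (level u + level u)) same ⟨
    level u + (level u + level u)                                 ≡⟨ cong (λ z → level u + (level u + z)) (+-identityʳ (level u)) ⟨
    3 * level u                                                   ∎
    where open ≤-Reasoning

  module PushDownCycle {u v : ℕ} (u≢v : ¬ u ≡ v) (same-level : level u ≡ level v) where

    0<u : 0 < u
    0<u = n≢0⇒n>0 λ { refl → u≢v (sym (level≡0⇒≡0 v (sym same-level))) }

    u∉upPath-v : u ∉ upPath v
    u∉upPath-v u∈ with ∈upPath⇒≡⊎level< v u∈
    ... | inj₁ u≡v = u≢v u≡v
    ... | inj₂ lt  = <-irrefl same-level lt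

    private
      origin-pd : ∀ x → origin (pdSwaps u v) x ≡ origin (upPath v) (origin (rootExchange u) x)
      origin-pd x = trans (cong (λ cs → origin cs x) (pdSwaps-≢ u≢v)) (origin-++ (upPath v) (rootExchange u) x)

    origin-pd-self : origin (pdSwaps u v) u ≡ v
    origin-pd-self = begin
      origin (pdSwaps u v) u                        ≡⟨ origin-pd u ⟩
      origin (upPath v) (origin (rootExchange u) u) ≡⟨ cong (origin (upPath v)) (origin-rootExchange-self u 0<u) ⟩
      origin (upPath v) 0                           ≡⟨ origin-upPath-root v ⟩
      v                                             ∎
      where open ≡-Reasoning

    origin-pd-∈ : ∀ {x} → x ∈ upPath v → origin (pdSwaps u v) x ≡ parent x
    origin-pd-∈ {x} x∈ = begin
      origin (pdSwaps u v) x                        ≡⟨ origin-pd x ⟩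
      origin (upPath v) (origin (rootExchange u) x) ≡⟨ cong (origin (upPath v)) (origin-rootExchange-other u 0<u x≢0 x≢u) ⟩
      origin (upPath v) x                           ≡⟨ origin-upPath-∈ v x∈ ⟩
      parent x                                      ∎
      where
      open ≡-Reasoning
      x≢0 : ¬ x ≡ 0
      x≢0 refl = 0∉upPath v x∈
      x≢u : ¬ x ≡ u
      x≢u refl = u∉upPath-v x∈

    origin-pd-other : ∀ {x} → ¬ x ≡ 0 → ¬ x ≡ u → x ∉ upPath v → origin (pdSwaps u v) x ≡ x
    origin-pd-other {x} x≢0 x≢u x∉ = begin
      origin (pdSwaps u v) x                        ≡⟨ origin-pd x ⟩
      origin (upPath v) (origin (rootExchange u) x) ≡⟨ cong (origin (upPath v)) (origin-rootExchange-other u 0<u x≢0 x≢u) ⟩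
      origin (upPath v) x                           ≡⟨ origin-upPath-∉ v x∉ x≢0 ⟩
      x                                             ∎
      where open ≡-Reasoning

  -- Finite sums and counting

  sumTo : ℕ → (ℕ → ℕ) → ℕ
  sumTo zero    f = 0
  sumTo (suc n) f = sumTo n f + f n

  sumTo-cong : ∀ n {f g} → (∀ k → k < n → f k ≡ g k) → sumTo n f ≡ sumTo n g
  sumTo-cong zero    _   = refl
  sumTo-cong (suc n) f≗g = cong₂ _+_ (sumTo-cong n (λ k k<n → f≗g k (m<n⇒m<1+n k<n))) (f≗g n ≤-refl)

  sumTo-mono-≤ : ∀ n {f g} → (∀ k → k < n → f k ≤ g k) → sumTo n f ≤ sumTo n g
  sumTo-mono-≤ zero    _   = z≤n
  sumTo-mono-≤ (suc n) f≤g = +-mono-≤ (sumTo-mono-≤ n (λ k k<n → f≤g k (m<n⇒m<1+n k<n))) (f≤g n ≤-refl)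

  sumTo-distrib-+ : ∀ n f g → sumTo n (λ k → f k + g k) ≡ sumTo n f + sumTo n g
  sumTo-distrib-+ zero    f g = refl
  sumTo-distrib-+ (suc n) f g rewrite sumTo-distrib-+ n f g = ring (sumTo n f) (sumTo n g) (f n) (g n)
    where
    ring : ∀ a b c d → a + b + (c + d) ≡ a + c + (b + d)
    ring = solve-∀

  sumTo-const : ∀ n c → sumTo n (λ _ → c) ≡ n * c
  sumTo-const zero    c = refl
  sumTo-const (suc n) c rewrite sumTo-const n c = +-comm (n * c) c

  sumTo-*ˡ : ∀ n c f → sumTo n (λ k → c * f k) ≡ c * sumTo n f
  sumTo-*ˡ zero    c f = sym (*-zeroʳ c)
  sumTo-*ˡ (suc n) c f rewrite sumTo-*ˡ n c f = sym (*-distribˡ-+ c (sumTo n f) (f n))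

  sumTo-halves : ∀ n f → sumTo (2 * n) (λ j → f (j / 2)) ≡ 2 * sumTo n f
  sumTo-halves zero    f = refl
  sumTo-halves (suc n) f = begin
    sumTo (2 * suc n) (λ j → f (j / 2))                               ≡⟨ cong (λ m → sumTo m (λ j → f (j / 2))) (+-suc (suc n) (n + 0)) ⟩
    sumTo (2 * n) (λ j → f (j / 2)) + f (2 * n / 2) + f (suc (2 * n) / 2) ≡⟨ cong₂ (λ a b → a + f b + f (suc (2 * n) / 2)) (sumTo-halves n f) (2*m/2≡m n) ⟩
    2 * sumTo n f + f n + f (suc (2 * n) / 2)                         ≡⟨ cong (λ b → 2 * sumTo n f + f n + f b) ([1+2*m]/2≡m n) ⟩
    2 * sumTo n f + f n + f n                                         ≡⟨ ring (sumTo n f) (f n) ⟩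
    2 * (sumTo n f + f n)                                             ∎
    where
    open ≡-Reasoning
    ring : ∀ a b → 2 * a + b + b ≡ 2 * (a + b)
    ring = solve-∀

  sumTo-suc : ∀ n f → sumTo (suc n) f ≡ f 0 + sumTo n (λ j → f (suc j))
  sumTo-suc zero    f = +-comm 0 (f 0)
  sumTo-suc (suc n) f = trans (cong (_+ f (suc n)) (sumTo-suc n f)) (+-assoc (f 0) _ _)

  sumOver : List ℕ → (ℕ → ℕ) → ℕ
  sumOver []       f = 0
  sumOver (x ∷ xs) f = f x + sumOver xs f

  sumOver-cong : ∀ xs {f g} → (∀ {x} → x ∈ xs → f x ≡ g x) → sumOver xs f ≡ sumOver xs g
  sumOver-cong []       _   = refl
  sumOver-cong (x ∷ xs) f≗g = cong₂ _+_ (f≗g (here refl)) (sumOver-cong xs (λ y∈ → f≗g (there y∈)))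

  update : (ℕ → ℕ) → ℕ → ℕ → ℕ → ℕ
  update f s c k with k ≟ s
  ... | yes _ = c
  ... | no  _ = f k

  update-≡ : ∀ f s c → update f s c s ≡ c
  update-≡ f s c with s ≟ s
  ... | yes _   = refl
  ... | no s≢s = ⊥-elim (s≢s refl)

  update-≢ : ∀ f s c {k} → ¬ k ≡ s → update f s c k ≡ f k
  update-≢ f s c {k} k≢s with k ≟ s
  ... | yes k≡s = ⊥-elim (k≢s k≡s)
  ... | no  _   = refl

  sumTo-update : ∀ n {s} → s < n → ∀ f c → sumTo n f + c ≡ sumTo n (update f s c) + f s
  sumTo-update zero    ()  f c
  sumTo-update (suc n) {s} s<1+n f c with s ≟ n
  ... | yes refl = begin
    sumTo s f + f s + c                            ≡⟨ xy∙z≈xz∙y (sumTo s f) (f s) c ⟩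
    sumTo s f + c + f s                            ≡⟨ cong (λ z → z + c + f s) (sumTo-cong s (λ k k<s → sym (update-≢ f s c (<⇒≢ k<s)))) ⟩
    sumTo s (update f s c) + c + f s               ≡⟨ cong (λ z → sumTo s (update f s c) + z + f s) (update-≡ f s c) ⟨
    sumTo s (update f s c) + update f s c s + f s  ∎
    where open ≡-Reasoning
  ... | no s≢n = begin
    sumTo n f + f n + c                            ≡⟨ xy∙z≈xz∙y (sumTo n f) (f n) c ⟩
    sumTo n f + c + f n                            ≡⟨ cong (_+ f n) (sumTo-update n (≤∧≢⇒< (s≤s⁻¹ s<1+n) s≢n) f c) ⟩
    sumTo n (update f s c) + f s + f n             ≡⟨ xy∙z≈xz∙y (sumTo n (update f s c)) (f s) (f n) ⟩
    sumTo n (update f s c) + f n + f s             ≡⟨ cong (λ z → sumTo n (update f s c) + z + f s) (update-≢ f s c (≢-sym s≢n)) ⟨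
    sumTo n (update f s c) + update f s c n + f s  ∎
    where open ≡-Reasoning

  sumTo-exchange : ∀ n S → Unique S → All (_< n) S → ∀ f g → (∀ k → k < n → k ∉ S → f k ≡ g k) →
                   sumTo n f + sumOver S g ≡ sumTo n g + sumOver S f
  sumTo-exchange n []      _          _            f g f≗g =
    cong (_+ 0) (sumTo-cong n (λ k k<n → f≗g k k<n λ ()))
  sumTo-exchange n (s ∷ S) (s∉ ∷ uniq) (s<n ∷ S<n) f g f≗g = begin
    sumTo n f + (g s + sumOver S g)        ≡⟨ +-assoc (sumTo n f) (g s) (sumOver S g) ⟨
    sumTo n f + g s + sumOver S g          ≡⟨ cong (_+ sumOver S g) (sumTo-update n s<n f (g s)) ⟩
    sumTo n f′ + f s + sumOver S g         ≡⟨ xy∙z≈xz∙y (sumTo n f′) (f s) (sumOver S g) ⟩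
    sumTo n f′ + sumOver S g + f s         ≡⟨ cong (_+ f s) (sumTo-exchange n S uniq S<n f′ g f′≗g) ⟩
    sumTo n g + sumOver S f′ + f s         ≡⟨ cong (λ z → sumTo n g + z + f s) (sumOver-cong S λ k∈ → update-≢ f s (g s) (λ { refl → All¬⇒¬Any s∉ k∈ })) ⟩
    sumTo n g + sumOver S f + f s          ≡⟨ +-assoc (sumTo n g) (sumOver S f) (f s) ⟩
    sumTo n g + (sumOver S f + f s)        ≡⟨ cong (sumTo n g +_) (+-comm (sumOver S f) (f s)) ⟩
    sumTo n g + (f s + sumOver S f)        ∎
    where
    open ≡-Reasoning
    f′ = update f s (g s)
    f′≗g : ∀ k → k < n → k ∉ S → f′ k ≡ g k
    f′≗g k k<n k∉ with k ≟ s
    ... | yes refl = refl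
    ... | no  k≢s  = f≗g k k<n λ { (here k≡s) → k≢s k≡s ; (there k∈) → k∉ k∈ }

  𝟙 : ∀ {A : Set} → Dec A → ℕ
  𝟙 (yes _) = 1
  𝟙 (no  _) = 0

  𝟙-yes : ∀ {A : Set} (a? : Dec A) → A → 𝟙 a? ≡ 1
  𝟙-yes (yes _) _ = refl
  𝟙-yes (no ¬a) a = ⊥-elim (¬a a)

  𝟙-no : ∀ {A : Set} (a? : Dec A) → ¬ A → 𝟙 a? ≡ 0
  𝟙-no (yes a) ¬a = ⊥-elim (¬a a)
  𝟙-no (no  _) _  = refl

  𝟙-mono : ∀ {A B : Set} (a? : Dec A) (b? : Dec B) → (A → B) → 𝟙 a? ≤ 𝟙 b?
  𝟙-mono (yes _) (yes _) _   = ≤-refl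
  𝟙-mono (yes a) (no ¬b) a→b = ⊥-elim (¬b (a→b a))
  𝟙-mono (no  _) _       _   = z≤n

  𝟙-cong : ∀ {A B : Set} (a? : Dec A) (b? : Dec B) → (A → B) → (B → A) → 𝟙 a? ≡ 𝟙 b?
  𝟙-cong a? b? a→b b→a = ≤-antisym (𝟙-mono a? b? a→b) (𝟙-mono b? a? b→a)

  𝟙≤1 : ∀ {A : Set} (a? : Dec A) → 𝟙 a? ≤ 1
  𝟙≤1 (yes _) = ≤-refl
  𝟙≤1 (no  _) = z≤n

  count : ∀ {P : ℕ → Set} → (∀ y → Dec (P y)) → ℕ → ℕ
  count P? n = sumTo n (λ y → 𝟙 (P? y))

  count≤ : ∀ {P : ℕ → Set} (P? : ∀ y → Dec (P y)) n → count P? n ≤ n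
  count≤ P? zero    = z≤n
  count≤ P? (suc n) = ≤-trans (+-mono-≤ (count≤ P? n) (𝟙≤1 (P? n))) (≤-reflexive (+-comm n 1))

  count-< : ∀ n b → count (_<? b) n ≤ b
  count-< zero    b = z≤n
  count-< (suc n) b with n <? b
  ... | yes n<b = ≤-trans (≤-reflexive (+-comm (count (_<? b) n) 1)) (≤-trans (s≤s (count≤ (_<? b) n)) n<b)
  ... | no  _   = ≤-trans (≤-reflexive (+-identityʳ _)) (count-< n b)

  _∖?_ : ∀ {P : ℕ → Set} → (∀ y → Dec (P y)) → ∀ c y → Dec (P y × ¬ y ≡ c)
  (P? ∖? c) y = P? y ×-dec ¬? (y ≟ c)

  count-split : ∀ {P : ℕ → Set} (P? : ∀ y → Dec (P y)) n {c} → c < n → count P? n ≡ count (P? ∖? c) n + 𝟙 (P? c)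
  count-split P? zero    ()
  count-split P? (suc n) {c} c<1+n with c ≟ n
  ... | yes refl = begin
    count P? c + 𝟙 (P? c)                          ≡⟨ cong (_+ 𝟙 (P? c)) (sumTo-cong c λ k k<c → 𝟙-cong (P? k) ((P? ∖? c) k) (_, <⇒≢ k<c) proj₁) ⟩
    count (P? ∖? c) c + 𝟙 (P? c)                   ≡⟨ cong (count (P? ∖? c) c +_) (+-identityˡ (𝟙 (P? c))) ⟨
    count (P? ∖? c) c + (0 + 𝟙 (P? c))             ≡⟨ cong (λ z → count (P? ∖? c) c + (z + 𝟙 (P? c))) (𝟙-no ((P? ∖? c) c) λ p → proj₂ p refl) ⟨
    count (P? ∖? c) c + (𝟙 ((P? ∖? c) c) + 𝟙 (P? c)) ≡⟨ +-assoc (count (P? ∖? c) c) _ _ ⟨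
    count (P? ∖? c) c + 𝟙 ((P? ∖? c) c) + 𝟙 (P? c)  ∎
    where open ≡-Reasoning
  ... | no c≢n = begin
    count P? n + 𝟙 (P? n)                           ≡⟨ cong (_+ 𝟙 (P? n)) (count-split P? n (≤∧≢⇒< (s≤s⁻¹ c<1+n) c≢n)) ⟩
    count (P? ∖? c) n + 𝟙 (P? c) + 𝟙 (P? n)         ≡⟨ xy∙z≈xz∙y (count (P? ∖? c) n) (𝟙 (P? c)) (𝟙 (P? n)) ⟩
    count (P? ∖? c) n + 𝟙 (P? n) + 𝟙 (P? c)         ≡⟨ cong (λ z → count (P? ∖? c) n + z + 𝟙 (P? c)) (𝟙-cong (P? n) ((P? ∖? c) n) (_, ≢-sym c≢n) proj₁) ⟩
    count (P? ∖? c) n + 𝟙 ((P? ∖? c) n) + 𝟙 (P? c)  ∎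
    where open ≡-Reasoning

  count-≡ : ∀ n {c} → c < n → count (_≟ c) n ≡ 1
  count-≡ n {c} c<n = begin
    count (_≟ c) n                              ≡⟨ count-split (_≟ c) n c<n ⟩
    count ((_≟ c) ∖? c) n + 𝟙 (c ≟ c)           ≡⟨ cong₂ _+_ (sumTo-cong n λ k _ → 𝟙-no (((_≟ c) ∖? c) k) λ p → proj₂ p (proj₁ p)) (𝟙-yes (c ≟ c) refl) ⟩
    sumTo n (λ _ → 0) + 1                       ≡⟨ cong (_+ 1) (trans (sumTo-const n 0) (*-zeroʳ n)) ⟩
    1                                           ∎
    where open ≡-Reasoning

  count-injective : ∀ {P : ℕ → Set} (P? : ∀ y → Dec (P y)) n m (f : ℕ → ℕ) →
                    (∀ {i j} → i < m → j < m → f i ≡ f j → i ≡ j) → (∀ {j} → j < m → f j < n) →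
                    sumTo m (λ j → 𝟙 (P? (f j))) ≤ count P? n
  count-injective P? n zero    f _   _  = z≤n
  count-injective P? n (suc m) f inj f< = begin
    sumTo m (λ j → 𝟙 (P? (f j))) + 𝟙 (P? (f m))             ≡⟨ cong (_+ 𝟙 (P? (f m))) (sumTo-cong m same) ⟩
    sumTo m (λ j → 𝟙 ((P? ∖? f m) (f j))) + 𝟙 (P? (f m))    ≤⟨ +-monoˡ-≤ _ (count-injective (P? ∖? f m) n m f
                                                                (λ i<m j<m → inj (m<n⇒m<1+n i<m) (m<n⇒m<1+n j<m))
                                                                (λ j<m → f< (m<n⇒m<1+n j<m))) ⟩
    count (P? ∖? f m) n + 𝟙 (P? (f m))                       ≡⟨ count-split P? n (f< ≤-refl) ⟨
    count P? n                                               ∎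
    where
    open ≤-Reasoning
    same : ∀ j → j < m → 𝟙 (P? (f j)) ≡ 𝟙 ((P? ∖? f m) (f j))
    same j j<m = 𝟙-cong (P? (f j)) ((P? ∖? f m) (f j)) (_, λ fj≡fm → <⇒≢ j<m (inj (m<n⇒m<1+n j<m) ≤-refl fj≡fm)) proj₁

  toℕ-transpose : ∀ {n} (i j k : Fin n) → toℕ (PC.transpose i j k) ≡ transposeℕ (toℕ i) (toℕ j) (toℕ k)
  toℕ-transpose i j k with k Fin.≟ i | toℕ k ≟ toℕ i
  ... | yes _   | yes _   = refl
  ... | yes k≡i | no  k≢i = ⊥-elim (k≢i (cong toℕ k≡i))
  ... | no  k≢i | yes k≡i = ⊥-elim (k≢i (toℕ-injective k≡i))
  ... | no  _   | no  _ with k Fin.≟ j | toℕ k ≟ toℕ j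
  ...   | yes _   | yes _   = refl
  ...   | yes k≡j | no  k≢j = ⊥-elim (k≢j (cong toℕ k≡j))
  ...   | no  k≢j | yes k≡j = ⊥-elim (k≢j (toℕ-injective k≡j))
  ...   | no  _   | no  _   = refl

  module _ {h : ℕ} where

    toℕ-node : ∀ {k} → k < size h → toℕ (node h k) ≡ k
    toℕ-node {k} k<n with k <? size h
    ... | yes k<n′ = toℕ-fromℕ< k<n′
    ... | no  k≮n  = ⊥-elim (k≮n k<n)

    node-toℕ : (x : Fin (size h)) → node h (toℕ x) ≡ x
    node-toℕ x = toℕ-injective (toℕ-node (toℕ<n x))

    node-injective : ∀ {a b} → a < size h → b < size h → node h a ≡ node h b → a ≡ b
    node-injective a<n b<n eq = trans (sym (toℕ-node a<n)) (trans (cong toℕ eq) (toℕ-node b<n))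

    transpose-node : ∀ {a b w} → a < size h → b < size h → w < size h →
                     PC.transpose (node h a) (node h b) (node h w) ≡ node h (transposeℕ a b w)
    transpose-node {a} {b} {w} a<n b<n w<n = toℕ-injective (begin
      toℕ (PC.transpose (node h a) (node h b) (node h w))                  ≡⟨ toℕ-transpose (node h a) (node h b) (node h w) ⟩
      transposeℕ (toℕ (node h a)) (toℕ (node h b)) (toℕ (node h w))        ≡⟨ cong₂ (λ x y → transposeℕ x y (toℕ (node h w))) (toℕ-node a<n) (toℕ-node b<n) ⟩
      transposeℕ a b (toℕ (node h w))                                       ≡⟨ cong (transposeℕ a b) (toℕ-node w<n) ⟩
      transposeℕ a b w                                                      ≡⟨ toℕ-node (transposeℕ-< a b w a<n b<n w<n) ⟨
      toℕ (node h (transposeℕ a b w))                                       ∎)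
      where open ≡-Reasoning

    el-applySwaps : ∀ (π : Config h) cs → All (_< size h) cs → ∀ {k} → k < size h →
                    el (applySwaps h π cs) (node h k) ≡ el π (node h (origin cs k))
    el-applySwaps π []       _            k<n = refl
    el-applySwaps π (c ∷ cs) (c<n ∷ cs<n) k<n = trans (el-applySwaps (swapUp h π c) cs cs<n k<n)
      (cong (el π) (transpose-node c<n (≤-<-trans (parent≤ c) c<n) (origin-< cs _ cs<n k<n)))

    el-nd : ∀ (π : Config h) e → el π (node h (toℕ (nd π e))) ≡ e
    el-nd π e = trans (cong (el π) (node-toℕ (nd π e))) (inverseʳ π)

  -- The potential

  -- The paper's per-element potential 4 · max(0, ℓ - 4 m), for an element at
  -- level ℓ in the online placement and level m in the offline one.
  φ : ℕ → ℕ → ℕ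
  φ l m = 4 * (l ∸ 4 * m)

  φ-root : ∀ m → φ 0 m ≡ 0
  φ-root m = cong (4 *_) (0∸n≡0 (4 * m))

  φ-suc : ∀ l m → φ (suc l) m ≤ φ l m + 4 * 𝟙 (4 * m ≤? l)
  φ-suc l m with 4 * m ≤? l
  ... | yes 4m≤l = ≤-reflexive (trans (cong (4 *_) (+-∸-assoc 1 4m≤l)) (ring (l ∸ 4 * m)))
    where
    ring : ∀ t → 4 * suc t ≡ 4 * t + 4 * 1
    ring = solve-∀
  ... | no  4m≰l = ≤-trans (≤-reflexive (cong (4 *_) (m≤n⇒m∸n≡0 (≰⇒> 4m≰l)))) z≤n

  φ-antitone : ∀ l {m m′} i → m ≤ m′ + i → φ l m′ ≤ φ l m + 16 * i
  φ-antitone l {m} {m′} i m≤m′+i = begin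
    4 * (l ∸ 4 * m′)               ≤⟨ *-monoʳ-≤ 4 (m≤n+o⇒m∸n≤o l (4 * m′) (begin
                                        l                             ≤⟨ m≤n+m∸n l (4 * m) ⟩
                                        4 * m + (l ∸ 4 * m)           ≤⟨ +-monoˡ-≤ (l ∸ 4 * m) (*-monoʳ-≤ 4 m≤m′+i) ⟩
                                        4 * (m′ + i) + (l ∸ 4 * m)    ≡⟨ ring m′ i (l ∸ 4 * m) ⟩
                                        4 * m′ + (l ∸ 4 * m + 4 * i)  ∎)) ⟩
    4 * (l ∸ 4 * m + 4 * i)        ≡⟨ ring′ (l ∸ 4 * m) i ⟩
    4 * (l ∸ 4 * m) + 16 * i       ∎
    where
    open ≤-Reasoning
    ring : ∀ a b c → 4 * (a + b) + c ≡ 4 * a + (c + 4 * b)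
    ring = solve-∀
    ring′ : ∀ a b → 4 * (a + 4 * b) ≡ 4 * a + 16 * b
    ring′ = solve-∀

  -- The proper ancestors x of v at which moving the element one level down raises
  -- φ, when g x is the offline level of the element at x.
  shallowAncestors : (ℕ → ℕ) → ℕ → ℕ
  shallowAncestors g v = sumOver (upPath v) (λ w → 𝟙 (4 * g (parent w) ≤? level (parent w)))

  shallowAncestors-suc : ∀ g k → shallowAncestors g (suc k) ≡
    𝟙 (4 * g (parent (suc k)) ≤? level (parent (suc k))) + shallowAncestors g (parent (suc k))
  shallowAncestors-suc g k = cong (λ xs → sumOver xs (λ w → 𝟙 (4 * g (parent w) ≤? level (parent w)))) (upPath-suc k)

  sumOver-upPath-suc : ∀ k f → sumOver (upPath (suc k)) f ≡ f (suc k) + sumOver (upPath (parent (suc k))) f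
  sumOver-upPath-suc k f = cong (λ xs → sumOver xs f) (upPath-suc k)

  upPath-φ-≤ : ∀ g v → φ (level v) (g v) + sumOver (upPath v) (λ w → φ (level w) (g (parent w)))
                       ≤ sumOver (upPath v) (λ w → φ (level w) (g w)) + 4 * shallowAncestors g v
  upPath-φ-≤ g = ancestor-induction _ (≤-reflexive (cong (_+ 0) (φ-root (g 0)))) step
    where
    pushed unpushed : ℕ → ℕ
    pushed   w = φ (level w) (g (parent w))
    unpushed w = φ (level w) (g w)
    step : ∀ k → φ (level (parent (suc k))) (g (parent (suc k))) + sumOver (upPath (parent (suc k))) pushed
                   ≤ sumOver (upPath (parent (suc k))) unpushed + 4 * shallowAncestors g (parent (suc k)) →
                 φ (level (suc k)) (g (suc k)) + sumOver (upPath (suc k)) pushed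
                   ≤ sumOver (upPath (suc k)) unpushed + 4 * shallowAncestors g (suc k)
    step k ih = begin
      φ lv (g v) + sumOver (upPath v) pushed                          ≡⟨ cong (φ lv (g v) +_) (sumOver-upPath-suc k pushed) ⟩
      φ lv (g v) + (φ lv (g p) + P)                                   ≤⟨ +-monoʳ-≤ (φ lv (g v)) (+-monoˡ-≤ P φ-step) ⟩
      φ lv (g v) + (φ (level p) (g p) + 4 * s + P)                    ≡⟨ ring (φ lv (g v)) (φ (level p) (g p)) (4 * s) P ⟩
      φ lv (g v) + 4 * s + (φ (level p) (g p) + P)                    ≤⟨ +-monoʳ-≤ (φ lv (g v) + 4 * s) ih ⟩
      φ lv (g v) + 4 * s + (U + 4 * shallowAncestors g p)             ≡⟨ ring′ (φ lv (g v)) s U (shallowAncestors g p) ⟩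
      (φ lv (g v) + U) + 4 * (s + shallowAncestors g p)               ≡⟨ cong₂ (λ a b → a + 4 * b) (sumOver-upPath-suc k unpushed) (shallowAncestors-suc g k) ⟨
      sumOver (upPath v) unpushed + 4 * shallowAncestors g v          ∎
      where
      open ≤-Reasoning
      v = suc k
      p = parent (suc k)
      lv = level v
      P = sumOver (upPath p) pushed
      U = sumOver (upPath p) unpushed
      s = 𝟙 (4 * g p ≤? level p)
      φ-step : φ lv (g p) ≤ φ (level p) (g p) + 4 * s
      φ-step = subst (λ l → φ l (g p) ≤ φ (level p) (g p) + 4 * s) (sym (level-suc k)) (φ-suc (level p) (g p))
      ring : ∀ a b c d → a + (b + c + d) ≡ a + c + (b + d)
      ring = solve-∀
      ring′ : ∀ a b c d → a + 4 * b + (c + 4 * d) ≡ (a + c) + 4 * (b + d)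
      ring′ = solve-∀

  Unique-upPath : ∀ v → Unique (upPath v)
  Unique-upPath = ancestor-induction _ [] step
    where
    step : ∀ k → Unique (upPath (parent (suc k))) → Unique (upPath (suc k))
    step k uniq = subst Unique (sym (upPath-suc k)) (¬Any⇒All¬ _ (suc∉upPath-parent k) ∷ uniq)

  exchange-≤ : ∀ a b x y c f q → a + (x + c) ≡ b + (y + f) → y + f ≤ c + q → a + x ≤ b + q
  exchange-≤ a b x y c f q eq y+f≤c+q = +-cancelʳ-≤ c (a + x) (b + q) (begin
    a + x + c        ≡⟨ +-assoc a x c ⟩
    a + (x + c)      ≡⟨ eq ⟩
    b + (y + f)      ≤⟨ +-monoʳ-≤ b y+f≤c+q ⟩
    b + (c + q)      ≡⟨ cong (b +_) (+-comm c q) ⟩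
    b + (q + c)      ≡⟨ +-assoc b q c ⟨
    b + q + c        ∎)
    where open ≤-Reasoning

  module _ (g : ℕ → ℕ) (n : ℕ) where

    private
      before : ℕ → ℕ
      before k = φ (level k) (g k)

      after : ℕ → ℕ → ℕ → ℕ
      after u v k = φ (level k) (g (origin (pdSwaps u v) k))

      pushed : ℕ → ℕ
      pushed w = φ (level w) (g (parent w))

      after≗pushed : ∀ u v → (∀ {x} → x ∈ upPath v → origin (pdSwaps u v) x ≡ parent x) →
                     ∀ {x} → x ∈ upPath v → after u v x ≡ pushed x
      after≗pushed u v origin∈ {x} x∈ = cong (λ y → φ (level x) (g y)) (origin∈ x∈)

    pushDown-self-φ-≤ : ∀ {v} → v < n →
      sumTo n (after v v) + φ (level v) (g v) ≤ sumTo n before + 4 * shallowAncestors g v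
    pushDown-self-φ-≤ {v} v<n = exchange-≤ (sumTo n (after v v)) (sumTo n before) (φ (level v) (g v)) (φ (level v) (g v))
      (sumOver (upPath v) before) (sumOver (upPath v) pushed) (4 * shallowAncestors g v) eq (upPath-φ-≤ g v)
      where
      origin-pd : ∀ x → origin (pdSwaps v v) x ≡ origin (upPath v) x
      origin-pd x = cong (λ cs → origin cs x) (pdSwaps-≡ v)
      unmoved : ∀ k → k < n → k ∉ upPath v → after v v k ≡ before k
      unmoved zero    _ _  = trans (φ-root (g (origin (pdSwaps v v) 0))) (sym (φ-root (g 0)))
      unmoved (suc k) _ k∉ = cong (λ y → φ (level (suc k)) (g y)) (trans (origin-pd (suc k)) (origin-upPath-∉ v k∉ λ ()))
      exchanged : sumTo n (after v v) + sumOver (upPath v) before ≡ sumTo n before + sumOver (upPath v) pushed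
      exchanged = trans (sumTo-exchange n (upPath v) (Unique-upPath v) (upPath-< v v<n) (after v v) before unmoved)
                        (cong (sumTo n before +_) (sumOver-cong (upPath v)
                          (after≗pushed v v (λ {x} x∈ → trans (origin-pd x) (origin-upPath-∈ v x∈)))))
      eq : sumTo n (after v v) + (φ (level v) (g v) + sumOver (upPath v) before)
           ≡ sumTo n before + (φ (level v) (g v) + sumOver (upPath v) pushed)
      eq = begin
        sumTo n (after v v) + (x + sumOver (upPath v) before) ≡⟨ x∙yz≈y∙xz (sumTo n (after v v)) x _ ⟩
        x + (sumTo n (after v v) + sumOver (upPath v) before) ≡⟨ cong (x +_) exchanged ⟩
        x + (sumTo n before + sumOver (upPath v) pushed)      ≡⟨ x∙yz≈y∙xz (sumTo n before) x _ ⟨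
        sumTo n before + (x + sumOver (upPath v) pushed)      ∎
        where
        open ≡-Reasoning
        x = φ (level v) (g v)

    pushDown-φ-≤ : ∀ {u v} → u < n → v < n → ¬ u ≡ v → level u ≡ level v →
      sumTo n (after u v) + φ (level u) (g u) ≤ sumTo n before + 4 * shallowAncestors g v
    pushDown-φ-≤ {u} {v} u<n v<n u≢v same =
      exchange-≤ (sumTo n (after u v)) (sumTo n before) (φ (level u) (g u)) (φ (level u) (g v))
        (sumOver (upPath v) before) (sumOver (upPath v) pushed) (4 * shallowAncestors g v)
        exchanged (subst (λ l → φ l (g v) + _ ≤ _) (sym same) (upPath-φ-≤ g v))
      where
      open PushDownCycle u≢v same
      unmoved : ∀ k → k < n → k ∉ u ∷ upPath v → after u v k ≡ before k
      unmoved zero    _ _  = trans (φ-root (g (origin (pdSwaps u v) 0))) (sym (φ-root (g 0)))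
      unmoved (suc k) _ k∉ = cong (λ y → φ (level (suc k)) (g y))
        (origin-pd-other (λ ()) (λ k≡u → k∉ (here k≡u)) (λ k∈ → k∉ (there k∈)))
      exchanged : sumTo n (after u v) + (φ (level u) (g u) + sumOver (upPath v) before)
                  ≡ sumTo n before + (φ (level u) (g v) + sumOver (upPath v) pushed)
      exchanged = trans (sumTo-exchange n (u ∷ upPath v) (¬Any⇒All¬ _ u∉upPath-v ∷ Unique-upPath v)
                           (u<n ∷ upPath-< v v<n) (after u v) before unmoved)
                        (cong (sumTo n before +_) (cong₂ _+_
                          (cong (λ y → φ (level u) (g y)) origin-pd-self)
                          (sumOver-cong (upPath v) (after≗pushed u v origin-pd-∈))))

  level≤level-transposeℕ+𝟙 : ∀ c t → level t ≤ level (transposeℕ (parent c) c t) + 𝟙 (t ≟ c)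
  level≤level-transposeℕ+𝟙 c t with t ≟ parent c
  ... | yes refl = ≤-trans (level-parent≤ c) (m≤m+n _ _)
  ... | no  _ with t ≟ c
  ...   | yes refl = ≤-trans (level≤1+level-parent c) (≤-reflexive (+-comm 1 _))
  ...   | no  _    = m≤m+n _ _

  module _ {h : ℕ} where

    optNode : Config h → Config h → ℕ → ℕ
    optNode π ρ k = toℕ (nd ρ (el π (node h k)))

    optLevel : Config h → Config h → ℕ → ℕ
    optLevel π ρ k = level (optNode π ρ k)

    optNode-injective : ∀ (π ρ : Config h) {i j} → i < size h → j < size h → optNode π ρ i ≡ optNode π ρ j → i ≡ j
    optNode-injective π ρ {i} {j} i<n j<n eq = node-injective i<n j<n (begin
      node h i                   ≡⟨ inverseˡ π ⟨
      nd π (el π (node h i))     ≡⟨ cong (nd π) el-eq ⟩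
      nd π (el π (node h j))     ≡⟨ inverseˡ π ⟩
      node h j                   ∎)
      where
      open ≡-Reasoning
      el-eq : el π (node h i) ≡ el π (node h j)
      el-eq = trans (sym (inverseʳ ρ)) (trans (cong (el ρ) (toℕ-injective eq)) (inverseʳ ρ))

    Φ : Config h → Config h → ℕ
    Φ π ρ = sumTo (size h) (λ k → φ (level k) (optLevel π ρ k))

    Φ-self : ∀ π → Φ π π ≡ 0
    Φ-self π = begin
      Φ π π                          ≡⟨ sumTo-cong (size h) (λ k k<n → trans (cong (λ x → φ (level k) (level x)) (nd-el k<n)) (φ-self (level k))) ⟩
      sumTo (size h) (λ _ → 0)       ≡⟨ sumTo-const (size h) 0 ⟩
      size h * 0                     ≡⟨ *-zeroʳ (size h) ⟩
      0                              ∎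
      where
      open ≡-Reasoning
      nd-el : ∀ {k} → k < size h → toℕ (nd π (el π (node h k))) ≡ k
      nd-el k<n = trans (cong toℕ (inverseˡ π)) (toℕ-node k<n)
      φ-self : ∀ l → φ l l ≡ 0
      φ-self l = cong (4 *_) (m≤n⇒m∸n≡0 (m≤n*m l 4))

    -- One offline swap lifts a single element by one level, so it raises Φ by at most 16.
    Φ-swapUp : ∀ (π ρ : Config h) {c} → c < size h → Φ π (swapUp h ρ c) ≤ Φ π ρ + 16
    Φ-swapUp π ρ {c} c<n = begin
      Φ π (swapUp h ρ c)                                                 ≤⟨ sumTo-mono-≤ (size h) pointwise ⟩
      sumTo (size h) (λ k → φ (level k) (optLevel π ρ k) + 16 * 𝟙 (f k ≟ c)) ≡⟨ sumTo-distrib-+ (size h) _ _ ⟩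
      Φ π ρ + sumTo (size h) (λ k → 16 * 𝟙 (f k ≟ c))                     ≡⟨ cong (Φ π ρ +_) (sumTo-*ˡ (size h) 16 _) ⟩
      Φ π ρ + 16 * sumTo (size h) (λ k → 𝟙 (f k ≟ c))                     ≤⟨ +-monoʳ-≤ (Φ π ρ) (*-monoʳ-≤ 16 (≤-trans
                                                                              (count-injective (_≟ c) (size h) (size h) f (optNode-injective π ρ) (λ _ → toℕ<n _))
                                                                              (≤-reflexive (count-≡ (size h) c<n)))) ⟩
      Φ π ρ + 16 * 1                                                     ∎
      where
      open ≤-Reasoning
      f = optNode π ρ
      pc<n = ≤-<-trans (parent≤ c) c<n
      level-after : ∀ k → level (f k) ≤ optLevel π (swapUp h ρ c) k + 𝟙 (f k ≟ c)
      level-after k = subst (λ x → level (f k) ≤ level x + 𝟙 (f k ≟ c))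
        (sym (trans (toℕ-transpose (node h (parent c)) (node h c) (nd ρ (el π (node h k))))
                    (cong₂ (λ a b → transposeℕ a b (f k)) (toℕ-node pc<n) (toℕ-node c<n))))
        (level≤level-transposeℕ+𝟙 c (f k))
      pointwise : ∀ k → k < size h → φ (level k) (optLevel π (swapUp h ρ c) k) ≤ φ (level k) (optLevel π ρ k) + 16 * 𝟙 (f k ≟ c)
      pointwise k _ = φ-antitone (level k) (𝟙 (f k ≟ c)) (level-after k)

    Φ-applySwaps : ∀ (π ρ : Config h) cs → All (_< size h) cs → Φ π (applySwaps h ρ cs) ≤ Φ π ρ + 16 * length cs
    Φ-applySwaps π ρ []       _            = m≤m+n _ _
    Φ-applySwaps π ρ (c ∷ cs) (c<n ∷ cs<n) = begin
      Φ π (applySwaps h (swapUp h ρ c) cs)    ≤⟨ Φ-applySwaps π (swapUp h ρ c) cs cs<n ⟩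
      Φ π (swapUp h ρ c) + 16 * length cs     ≤⟨ +-monoˡ-≤ _ (Φ-swapUp π ρ c<n) ⟩
      Φ π ρ + 16 + 16 * length cs             ≡⟨ ring (Φ π ρ) (length cs) ⟩
      Φ π ρ + 16 * suc (length cs)            ∎
      where
      open ≤-Reasoning
      ring : ∀ a l → a + 16 + 16 * l ≡ a + 16 * suc l
      ring = solve-∀

    Φ-pushDown : ∀ (π ρ : Config h) e {v} → v < size h → level (toℕ (nd π e)) ≡ level v →
      Φ (applySwaps h π (pdSwaps (toℕ (nd π e)) v)) ρ + φ (level (toℕ (nd π e))) (levelOf ρ e)
        ≤ Φ π ρ + 4 * shallowAncestors (optLevel π ρ) v
    Φ-pushDown π ρ e {v} v<n same = subst₂ (λ a b → a + φ (level u) b ≤ Φ π ρ + 4 * shallowAncestors (optLevel π ρ) v)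
      (sym Φ-after) (cong (levelOf ρ) (el-nd π e)) (bound (u ≟ v))
      where
      u = toℕ (nd π e)
      u<n = toℕ<n (nd π e)
      g = optLevel π ρ
      Φ-after : Φ (applySwaps h π (pdSwaps u v)) ρ ≡ sumTo (size h) (λ k → φ (level k) (g (origin (pdSwaps u v) k)))
      Φ-after = sumTo-cong (size h) (λ k k<n → cong (λ x → φ (level k) (levelOf ρ x))
                  (el-applySwaps π (pdSwaps u v) (pdSwaps-< u v u<n v<n) k<n))
      bound : Dec (u ≡ v) → sumTo (size h) (λ k → φ (level k) (g (origin (pdSwaps u v) k))) + φ (level u) (g u)
                            ≤ Φ π ρ + 4 * shallowAncestors g v
      bound (yes refl) = pushDown-self-φ-≤ g (size h) v<n
      bound (no  u≢v)  = pushDown-φ-≤ g (size h) u<n v<n u≢v same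

  -- Averaging over the random node

  divMod4 : ℕ → ℕ × ℕ
  divMod4 zero    = 0 , 0
  divMod4 (suc d) = next (divMod4 d)
    where
    next : ℕ × ℕ → ℕ × ℕ
    next (q , 3) = suc q , 0
    next (q , r) = q , suc r

  quarter remainder4 : ℕ → ℕ
  quarter    d = proj₁ (divMod4 d)
  remainder4 d = proj₂ (divMod4 d)

  divMod4-correct : ∀ d → quarter d * 4 + remainder4 d ≡ d × remainder4 d ≤ 3
  divMod4-correct zero = refl , z≤n
  divMod4-correct (suc d) with divMod4 d | divMod4-correct d
  ... | q , 0 | eq , _ = trans (+-suc (q * 4) 0) (cong suc eq) , s≤s z≤n
  ... | q , 1 | eq , _ = trans (+-suc (q * 4) 1) (cong suc eq) , s≤s (s≤s z≤n)
  ... | q , 2 | eq , _ = trans (+-suc (q * 4) 2) (cong suc eq) , s≤s (s≤s (s≤s z≤n))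
  ... | q , 3 | eq , _ = trans (ring q) (cong suc eq) , z≤n
    where
    ring : ∀ q → suc q * 4 + 0 ≡ suc (q * 4 + 3)
    ring = solve-∀
  ... | q , suc (suc (suc (suc r))) | _ , s≤s (s≤s (s≤s ()))

  ≤quarter : ∀ {m d} → 4 * m ≤ d → m ≤ quarter d
  ≤quarter {m} {d} 4m≤d with ≤-<-connex m (quarter d)
  ... | inj₁ m≤q = m≤q
  ... | inj₂ q<m = ⊥-elim (<-irrefl refl (≤-<-trans 4m≤d (begin-strict
    d                                  ≡⟨ proj₁ (divMod4-correct d) ⟨
    quarter d * 4 + remainder4 d       ≤⟨ +-monoʳ-≤ (quarter d * 4) (proj₂ (divMod4-correct d)) ⟩
    quarter d * 4 + 3                  <⟨ ≤-reflexive (ring (quarter d)) ⟩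
    suc (quarter d) * 4                ≤⟨ *-monoˡ-≤ 4 q<m ⟩
    m * 4                              ≡⟨ *-comm m 4 ⟩
    4 * m                              ∎)))
    where
    open ≤-Reasoning
    ring : ∀ q → suc (q * 4 + 3) ≡ suc q * 4
    ring = solve-∀

  -- By V-step, V d / 2^d dominates the tail Σ_{i ≥ d} size (quarter i) / 2^i of the
  -- series that bounds w d / 2^d in geometric-bound.
  V : ℕ → ℕ
  V d = 2 * size (quarter d) + 2 ^ (quarter d + remainder4 d)

  private
    doubling : ∀ B x {y} → y ≡ 2 * x → 2 * B + y + 2 * B ≡ 2 * (2 * B + x)
    doubling B x refl = ring B x
      where
      ring : ∀ B x → 2 * B + 2 * x + 2 * B ≡ 2 * (2 * B + x)
      ring = solve-∀

  V-step : ∀ d → V (suc d) + 2 * size (quarter d) ≤ 2 * V d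
  V-step d with divMod4 d | divMod4-correct d
  ... | q , 0 | _ = ≤-reflexive (doubling (size q) (2 ^ (q + 0)) (cong (2 ^_) (+-suc q 0)))
  ... | q , 1 | _ = ≤-reflexive (doubling (size q) (2 ^ (q + 1)) (cong (2 ^_) (+-suc q 1)))
  ... | q , 2 | _ = ≤-reflexive (doubling (size q) (2 ^ (q + 2)) (cong (2 ^_) (+-suc q 2)))
  ... | q , 3 | _ = wrap (size q) (2 ^ q) (1+size≡2^[1+h] q) (cong (2 ^_) (+-identityʳ (suc q)))
                         (trans (^-distribˡ-+-* 2 q 3) (*-comm (2 ^ q) 8))
    where
    wrap : ∀ B p → suc B ≡ 2 * p → ∀ {y z} → y ≡ 2 * p → z ≡ 8 * p →
           2 * suc (2 * B) + y + 2 * B ≤ 2 * (2 * B + z)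
    wrap B p 1+B≡2p refl refl = begin
      2 * suc (2 * B) + 2 * p + 2 * B  ≡⟨ ring B p ⟩
      4 * B + 2 * suc B + 2 * p        ≡⟨ cong (λ z → 4 * B + 2 * z + 2 * p) 1+B≡2p ⟩
      4 * B + 2 * (2 * p) + 2 * p      ≡⟨ ring′ B p ⟩
      4 * B + 6 * p                    ≤⟨ +-monoʳ-≤ (4 * B) (*-monoˡ-≤ p (m≤m+n 6 10)) ⟩
      4 * B + 16 * p                   ≡⟨ ring″ B p ⟩
      2 * (2 * B + 8 * p)              ∎
      where
      open ≤-Reasoning
      ring : ∀ B p → 2 * suc (2 * B) + 2 * p + 2 * B ≡ 4 * B + 2 * suc B + 2 * p
      ring = solve-∀
      ring′ : ∀ B p → 4 * B + 2 * (2 * p) + 2 * p ≡ 4 * B + 6 * p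
      ring′ = solve-∀
      ring″ : ∀ B p → 4 * B + 16 * p ≡ 2 * (2 * B + 8 * p)
      ring″ = solve-∀
  ... | q , suc (suc (suc (suc r))) | _ , s≤s (s≤s (s≤s ()))

  geometric-bound : ∀ (w : ℕ → ℕ) D → w 0 ≡ 0 → (∀ d → d < D → w (suc d) ≤ 2 * (size (quarter d) + w d)) →
                    ∀ d → d ≤ D → 4 * w d ≤ 15 * 2 ^ d
  geometric-bound w D w0≡0 w-step d d≤D = ≤-trans (m≤m+n (4 * w d) (4 * V d)) (invariant d d≤D)
    where
    invariant : ∀ d → d ≤ D → 4 * w d + 4 * V d ≤ 15 * 2 ^ d
    invariant zero    _      rewrite w0≡0 = m≤m+n 12 3
    invariant (suc d) 1+d≤D = begin
      4 * w (suc d) + 4 * V (suc d)              ≤⟨ +-monoˡ-≤ (4 * V (suc d)) (*-monoʳ-≤ 4 (w-step d 1+d≤D)) ⟩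
      4 * (2 * (B + w d)) + 4 * V (suc d)        ≡⟨ ring B (w d) (V (suc d)) ⟩
      8 * w d + 4 * (V (suc d) + 2 * B)          ≤⟨ +-monoʳ-≤ (8 * w d) (*-monoʳ-≤ 4 (V-step d)) ⟩
      8 * w d + 4 * (2 * V d)                    ≡⟨ ring′ (w d) (V d) ⟩
      2 * (4 * w d + 4 * V d)                    ≤⟨ *-monoʳ-≤ 2 (invariant d (<⇒≤ 1+d≤D)) ⟩
      2 * (15 * 2 ^ d)                           ≡⟨ ring″ (2 ^ d) ⟩
      15 * 2 ^ suc d                             ∎
      where
      open ≤-Reasoning
      B = size (quarter d)
      ring : ∀ B w v → 4 * (2 * (B + w)) + 4 * v ≡ 8 * w + 4 * (v + 2 * B)
      ring = solve-∀
      ring′ : ∀ w v → 8 * w + 4 * (2 * v) ≡ 2 * (4 * w + 4 * v)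
      ring′ = solve-∀
      ring″ : ∀ p → 2 * (15 * p) ≡ 15 * (2 * p)
      ring″ = solve-∀

  module _ {h : ℕ} (π ρ : Config h) where

    private
      g : ℕ → ℕ
      g = optLevel π ρ

      shallow? : ∀ x → _
      shallow? x = 4 * g x ≤? level x

    shallowOnLevel : ℕ → ℕ
    shallowOnLevel d = sumTo (2 ^ d) (λ j → 𝟙 (shallow? (levelNode d j)))

    shallowAncestorsOnLevel : ℕ → ℕ
    shallowAncestorsOnLevel d = sumTo (2 ^ d) (λ j → shallowAncestors g (levelNode d j))

    shallowAncestorsOnLevel-suc : ∀ d → shallowAncestorsOnLevel (suc d) ≡ 2 * (shallowOnLevel d + shallowAncestorsOnLevel d)
    shallowAncestorsOnLevel-suc d = begin
      shallowAncestorsOnLevel (suc d)                                                       ≡⟨ sumTo-cong (2 * 2 ^ d) (λ j _ → via-parent j) ⟩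
      sumTo (2 * 2 ^ d) (λ j → 𝟙 (shallow? (levelNode d (j / 2))) + shallowAncestors g (levelNode d (j / 2)))
                                                                                            ≡⟨ sumTo-halves (2 ^ d) (λ i → 𝟙 (shallow? (levelNode d i)) + shallowAncestors g (levelNode d i)) ⟩
      2 * sumTo (2 ^ d) (λ i → 𝟙 (shallow? (levelNode d i)) + shallowAncestors g (levelNode d i))
                                                                                            ≡⟨ cong (2 *_) (sumTo-distrib-+ (2 ^ d) _ _) ⟩
      2 * (shallowOnLevel d + shallowAncestorsOnLevel d)                                    ∎
      where
      open ≡-Reasoning
      via-parent : ∀ j → shallowAncestors g (levelNode (suc d) j)
                         ≡ 𝟙 (shallow? (levelNode d (j / 2))) + shallowAncestors g (levelNode d (j / 2))
      via-parent j = trans (cong (shallowAncestors g) (levelNode-suc d j))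
        (trans (shallowAncestors-suc g (2 * (2 ^ d ∸ 1) + j))
          (cong (λ x → 𝟙 (shallow? x) + shallowAncestors g x) (trans (cong parent (sym (levelNode-suc d j))) (parent-levelNode d j))))

    shallowOnLevel≤ : ∀ d → d ≤ h → shallowOnLevel d ≤ size (quarter d)
    shallowOnLevel≤ d d≤h = begin
      shallowOnLevel d                          ≡⟨ sumTo-cong (2 ^ d) (λ j j<2^d → 𝟙-cong (shallow? (levelNode d j)) (P? (f j))
                                                     (subst (4 * g (levelNode d j) ≤_) (level-levelNode d j j<2^d))
                                                     (subst (4 * g (levelNode d j) ≤_) (sym (level-levelNode d j j<2^d)))) ⟩
      sumTo (2 ^ d) (λ j → 𝟙 (P? (f j)))        ≤⟨ count-injective P? (size h) (2 ^ d) f f-injective (λ _ → toℕ<n _) ⟩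
      count P? (size h)                         ≤⟨ sumTo-mono-≤ (size h) (λ y _ → 𝟙-mono (P? y) (y <? size (quarter d))
                                                     (λ 4l≤d → level≤⇒<size y (≤quarter 4l≤d))) ⟩
      count (_<? size (quarter d)) (size h)     ≤⟨ count-< (size h) (size (quarter d)) ⟩
      size (quarter d)                          ∎
      where
      open ≤-Reasoning
      P? : ∀ y → _
      P? y = 4 * level y ≤? d
      f : ℕ → ℕ
      f j = optNode π ρ (levelNode d j)
      f-injective : ∀ {i j} → i < 2 ^ d → j < 2 ^ d → f i ≡ f j → i ≡ j
      f-injective i<2^d j<2^d eq = +-cancelˡ-≡ (2 ^ d ∸ 1) _ _
        (optNode-injective π ρ (levelNode<size d≤h i<2^d) (levelNode<size d≤h j<2^d) eq)

    4*shallowAncestorsOnLevel≤ : ∀ d → d ≤ h → 4 * shallowAncestorsOnLevel d ≤ 15 * 2 ^ d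
    4*shallowAncestorsOnLevel≤ = geometric-bound shallowAncestorsOnLevel h refl λ d d<h →
      ≤-trans (≤-reflexive (shallowAncestorsOnLevel-suc d))
              (*-monoʳ-≤ 2 (+-monoˡ-≤ (shallowAncestorsOnLevel d) (shallowOnLevel≤ d (<⇒≤ d<h))))

    module _ (e : Fin (size h)) where

      private
        u d L : ℕ
        u = toℕ (nd π e)
        d = level u
        L = levelOf ρ e

      pushDownCost : ℕ → ℕ
      pushDownCost j = suc d + length (pdSwaps u (levelNode d j))

      potentialAfter : ℕ → ℕ
      potentialAfter j = Φ (applySwaps h π (pdSwaps u (levelNode d j))) ρ

      pushDown-amortised : sumTo (2 ^ d) (λ j → pushDownCost j + potentialAfter j) ≤ 2 ^ d * (16 * suc L + Φ π ρ)
      pushDown-amortised = +-cancelʳ-≤ (2 ^ d * φ d L) _ _ (begin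
        sumTo n (λ j → pushDownCost j + potentialAfter j) + n * φ d L      ≡⟨ cong (sumTo n (λ j → pushDownCost j + potentialAfter j) +_) (sumTo-const n (φ d L)) ⟨
        sumTo n (λ j → pushDownCost j + potentialAfter j) + sumTo n (λ _ → φ d L) ≡⟨ sumTo-distrib-+ n _ _ ⟨
        sumTo n (λ j → pushDownCost j + potentialAfter j + φ d L)           ≤⟨ sumTo-mono-≤ n pointwise ⟩
        sumTo n (λ j → A + 4 * shallowAncestors g (levelNode d j))          ≡⟨ sumTo-distrib-+ n _ _ ⟩
        sumTo n (λ _ → A) + sumTo n (λ j → 4 * shallowAncestors g (levelNode d j))
                                                                            ≡⟨ cong₂ _+_ (sumTo-const n A) (sumTo-*ˡ n 4 _) ⟩
        n * A + 4 * shallowAncestorsOnLevel d                               ≤⟨ +-monoʳ-≤ (n * A) (4*shallowAncestorsOnLevel≤ d d≤h) ⟩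
        n * A + 15 * n                                                      ≡⟨ ring n A ⟩
        n * (A + 15)                                                        ≤⟨ *-monoʳ-≤ n A+15≤ ⟩
        n * (16 * suc L + Φ π ρ + φ d L)                                    ≡⟨ *-distribˡ-+ n _ _ ⟩
        n * (16 * suc L + Φ π ρ) + n * φ d L                                ∎)
        where
        open ≤-Reasoning
        n = 2 ^ d
        A = suc (4 * d) + Φ π ρ
        d≤h : d ≤ h
        d≤h = <size⇒level≤ u (toℕ<n (nd π e))
        ring : ∀ n A → n * A + 15 * n ≡ n * (A + 15)
        ring = solve-∀
        pointwise : ∀ j → j < n → pushDownCost j + potentialAfter j + φ d L ≤ A + 4 * shallowAncestors g (levelNode d j)
        pointwise j j<n = begin
          pushDownCost j + potentialAfter j + φ d L                  ≡⟨ +-assoc (pushDownCost j) _ _ ⟩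
          pushDownCost j + (potentialAfter j + φ d L)                ≤⟨ +-mono-≤ (s≤s (+-monoʳ-≤ d (length-pdSwaps u v (sym same))))
                                                                                (Φ-pushDown π ρ e (levelNode<size d≤h j<n) (sym same)) ⟩
          suc (d + 3 * d) + (Φ π ρ + 4 * shallowAncestors g v)       ≡⟨ ring′ d (Φ π ρ) (4 * shallowAncestors g v) ⟩
          A + 4 * shallowAncestors g v                               ∎
          where
          v = levelNode d j
          same : level v ≡ d
          same = level-levelNode d j j<n
          ring′ : ∀ d P q → suc (d + 3 * d) + (P + q) ≡ suc (4 * d) + P + q
          ring′ = solve-∀
        -- 4 d ≤ 16 L + 4 (d ∸ 4 L): the depth cost is paid by the offline level or by φ.
        A+15≤ : A + 15 ≤ 16 * suc L + Φ π ρ + φ d L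
        A+15≤ = begin
          suc (4 * d) + Φ π ρ + 15                      ≡⟨ ring″ d (Φ π ρ) ⟩
          16 + Φ π ρ + 4 * d                            ≤⟨ +-monoʳ-≤ (16 + Φ π ρ) (*-monoʳ-≤ 4 (m≤n+m∸n d (4 * L))) ⟩
          16 + Φ π ρ + 4 * (4 * L + (d ∸ 4 * L))        ≡⟨ ring‴ (Φ π ρ) L (d ∸ 4 * L) ⟩
          16 * suc L + Φ π ρ + φ d L                    ∎
          where
          ring″ : ∀ d P → suc (4 * d) + P + 15 ≡ 16 + P + 4 * d
          ring″ = solve-∀
          ring‴ : ∀ P L x → 16 + P + 4 * (4 * L + x) ≡ 16 * suc L + P + 4 * x
          ring‴ = solve-∀

  module _ {h : ℕ} where

    offlineSwaps : List (Swap h) → List ℕ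
    offlineSwaps = map (λ s → toℕ (proj₁ s))

    offlineSwaps-< : ∀ ss → All (_< size h) (offlineSwaps ss)
    offlineSwaps-< []       = []
    offlineSwaps-< (s ∷ ss) = toℕ<n (proj₁ s) ∷ offlineSwaps-< ss

    -- The offline swaps ss of one request, then Random-Push serving e; c is the
    -- offline cost of the remaining requests.
    serve-amortised : ∀ (π ρ : Config h) ss e c → let ρ′ = applySwaps h ρ (offlineSwaps ss) in
      sumTo (2 ^ level (toℕ (nd π e))) (λ j → pushDownCost π ρ′ e j + (16 * c + potentialAfter π ρ′ e j))
        ≤ 2 ^ level (toℕ (nd π e)) * (16 * (length ss + suc (levelOf ρ′ e) + c) + Φ π ρ)
    serve-amortised π ρ ss e c = begin
      sumTo n (λ j → pushDownCost π ρ′ e j + (16 * c + potentialAfter π ρ′ e j))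
                                                            ≡⟨ sumTo-cong n (λ j _ → x∙yz≈y∙xz (pushDownCost π ρ′ e j) (16 * c) _) ⟩
      sumTo n (λ j → 16 * c + (pushDownCost π ρ′ e j + potentialAfter π ρ′ e j))
                                                            ≡⟨ sumTo-distrib-+ n _ _ ⟩
      sumTo n (λ _ → 16 * c) + sumTo n (λ j → pushDownCost π ρ′ e j + potentialAfter π ρ′ e j)
                                                            ≤⟨ +-mono-≤ (≤-reflexive (sumTo-const n (16 * c))) (pushDown-amortised π ρ′ e) ⟩
      n * (16 * c) + n * (16 * suc L′ + Φ π ρ′)             ≤⟨ +-monoʳ-≤ (n * (16 * c)) (*-monoʳ-≤ n (+-monoʳ-≤ (16 * suc L′) Φ-offline)) ⟩
      n * (16 * c) + n * (16 * suc L′ + (Φ π ρ + 16 * length ss))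
                                                            ≡⟨ ring n c L′ (Φ π ρ) (length ss) ⟩
      n * (16 * (length ss + suc L′ + c) + Φ π ρ)           ∎
      where
      open ≤-Reasoning
      ρ′ = applySwaps h ρ (offlineSwaps ss)
      n = 2 ^ level (toℕ (nd π e))
      L′ = levelOf ρ′ e
      Φ-offline : Φ π ρ′ ≤ Φ π ρ + 16 * length ss
      Φ-offline = subst (λ l → Φ π ρ′ ≤ Φ π ρ + 16 * l) (length-map _ ss) (Φ-applySwaps π ρ _ (offlineSwaps-< ss))
      ring : ∀ n c L P l → n * (16 * c) + n * (16 * suc L + (P + 16 * l)) ≡ n * (16 * (l + suc L + c) + P)
      ring = solve-∀

open import Data.Nat using (ℕ)
open import Data.Fin using (Fin)
open import Data.List using (List)
open import Data.Integer using (+_)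
open import Data.Rational using (_≤_; _*_; _/_)

import Data.Nat as ℕ
import Data.Nat.Properties as ℕₚ
import Data.Nat.Coprimality as Coprime
import Data.Integer as ℤ
import Data.Integer.Properties as ℤₚ
import Data.Rational as ℚ
open import Data.Rational using (ℚ; mkℚ; ½; 1ℚ)
import Data.Rational.Properties as ℚₚ
open import Data.Fin using (toℕ)
open import Data.List using ([]; _∷_; map; upTo; applyUpTo)
open import Data.Vec using ([]; _∷_)
open import Relation.Binary.PropositionalEquality

open Amortised

ℕtoℚ≡mkℚ : ∀ k → ℕtoℚ k ≡ mkℚ (+ k) 0 (Coprime.sym (Coprime.1-coprimeTo k))
ℕtoℚ≡mkℚ k = ℚₚ.normalize-coprime (Coprime.sym (Coprime.1-coprimeTo k))

ℕtoℚ-+ : ∀ a b → ℕtoℚ (a ℕ.+ b) ≡ ℕtoℚ a ℚ.+ ℕtoℚ b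
ℕtoℚ-+ a b = trans (cong (_/ 1) (sym (cong₂ ℤ._+_ (ℤₚ.*-identityʳ (+ a)) (ℤₚ.*-identityʳ (+ b)))))
                   (cong₂ ℚ._+_ (sym (ℕtoℚ≡mkℚ a)) (sym (ℕtoℚ≡mkℚ b)))

ℕtoℚ-* : ∀ a b → ℕtoℚ (a ℕ.* b) ≡ ℕtoℚ a * ℕtoℚ b
ℕtoℚ-* a b = trans (cong (_/ 1) (sym (ℤₚ.+◃n≡+n (a ℕ.* b)))) (cong₂ _*_ (sym (ℕtoℚ≡mkℚ a)) (sym (ℕtoℚ≡mkℚ b)))

ℕtoℚ-mono-≤ : ∀ {a b} → a ℕ.≤ b → ℕtoℚ a ≤ ℕtoℚ b
ℕtoℚ-mono-≤ {a} {b} a≤b = subst₂ _≤_ (sym (ℕtoℚ≡mkℚ a)) (sym (ℕtoℚ≡mkℚ b))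
  (ℚ.*≤* (subst₂ ℤ._≤_ (sym (ℤₚ.*-identityʳ (+ a))) (sym (ℤₚ.*-identityʳ (+ b))) (ℤ.+≤+ a≤b)))

sumℚ-map-≤ : ∀ (F : ℕ → ℚ) (H : ℕ → ℕ) xs → (∀ j → F j ≤ ℕtoℚ (H j)) → sumℚ (map F xs) ≤ ℕtoℚ (sumOver xs H)
sumℚ-map-≤ F H []       _    = ℚₚ.≤-refl
sumℚ-map-≤ F H (x ∷ xs) F≤H = subst (sumℚ (map F (x ∷ xs)) ≤_) (sym (ℕtoℚ-+ (H x) (sumOver xs H)))
  (ℚₚ.+-mono-≤ (F≤H x) (sumℚ-map-≤ F H xs F≤H))

sumOver-applyUpTo : ∀ n f H → sumOver (applyUpTo f n) H ≡ sumTo n (λ j → H (f j))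
sumOver-applyUpTo ℕ.zero    f H = refl
sumOver-applyUpTo (ℕ.suc n) f H = trans (cong (H (f 0) ℕ.+_) (sumOver-applyUpTo n (λ j → f (ℕ.suc j)) H))
                                        (sym (sumTo-suc n (λ j → H (f j))))

halfPow-nonNeg : ∀ d → ℚ.NonNegative (halfPow d)
halfPow-nonNeg ℕ.zero    = ℚ.nonNegative {1ℚ} (ℚₚ.<⇒≤ (ℚₚ.positive⁻¹ 1ℚ))
halfPow-nonNeg (ℕ.suc d) = ℚₚ.nonNeg*nonNeg⇒nonNeg ½ {{ℚ.nonNegative {½} (ℚₚ.<⇒≤ (ℚₚ.positive⁻¹ ½))}} (halfPow d) {{halfPow-nonNeg d}}

halfPow-*-2^ : ∀ d y → halfPow d * ℕtoℚ (2 ℕ.^ d ℕ.* y) ≡ ℕtoℚ y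
halfPow-*-2^ ℕ.zero    y = trans (ℚₚ.*-identityˡ (ℕtoℚ (1 ℕ.* y))) (cong ℕtoℚ (ℕₚ.*-identityˡ y))
halfPow-*-2^ (ℕ.suc d) y = begin
  (½ * halfPow d) * ℕtoℚ (2 ℕ.* 2 ℕ.^ d ℕ.* y)   ≡⟨ cong ((½ * halfPow d) *_) (trans (cong ℕtoℚ (ℕₚ.*-assoc 2 (2 ℕ.^ d) y)) (ℕtoℚ-* 2 (2 ℕ.^ d ℕ.* y))) ⟩
  (½ * halfPow d) * (ℕtoℚ 2 * x)                 ≡⟨ ℚₚ.*-assoc ½ (halfPow d) (ℕtoℚ 2 * x) ⟩
  ½ * (halfPow d * (ℕtoℚ 2 * x))                 ≡⟨ cong (½ *_) (ℚₚ.*-assoc (halfPow d) (ℕtoℚ 2) x) ⟨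
  ½ * ((halfPow d * ℕtoℚ 2) * x)                 ≡⟨ cong (λ z → ½ * (z * x)) (ℚₚ.*-comm (halfPow d) (ℕtoℚ 2)) ⟩
  ½ * ((ℕtoℚ 2 * halfPow d) * x)                 ≡⟨ cong (½ *_) (ℚₚ.*-assoc (ℕtoℚ 2) (halfPow d) x) ⟩
  ½ * (ℕtoℚ 2 * (halfPow d * x))                 ≡⟨ ℚₚ.*-assoc ½ (ℕtoℚ 2) (halfPow d * x) ⟨
  (½ * ℕtoℚ 2) * (halfPow d * x)                 ≡⟨ cong (1ℚ *_) (halfPow-*-2^ d y) ⟩
  1ℚ * ℕtoℚ y                                    ≡⟨ ℚₚ.*-identityˡ (ℕtoℚ y) ⟩
  ℕtoℚ y                                         ∎
  where
  open ≡-Reasoning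
  x = ℕtoℚ (2 ℕ.^ d ℕ.* y)

halfPow-*-≤ : ∀ d {z} y → z ℕ.≤ 2 ℕ.^ d ℕ.* y → halfPow d * ℕtoℚ z ≤ ℕtoℚ y
halfPow-*-≤ d y z≤ = subst (halfPow d * _ ≤_) (halfPow-*-2^ d y)
  (ℚₚ.*-monoˡ-≤-nonNeg (halfPow d) {{halfPow-nonNeg d}} (ℕtoℚ-mono-≤ z≤))

expCostRP≤16*costOpt+Φ : ∀ h (π ρ : Config h) σ (opt : OfflineAlg {h} σ) →
  expCostRP h π σ ≤ ℕtoℚ (16 ℕ.* costOpt h ρ σ opt ℕ.+ Φ π ρ)
expCostRP≤16*costOpt+Φ h π ρ []      []         = ℕtoℚ-mono-≤ {0} {16 ℕ.* 0 ℕ.+ Φ π ρ} ℕ.z≤n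
expCostRP≤16*costOpt+Φ h π ρ (e ∷ σ) (ss ∷ opt) = begin
  expCostRP h π (e ∷ σ)                      ≤⟨ ℚₚ.*-monoˡ-≤-nonNeg (halfPow d) {{halfPow-nonNeg d}} (sumℚ-map-≤ _ total (upTo n) branch≤) ⟩
  halfPow d * ℕtoℚ (sumOver (upTo n) total)  ≤⟨ halfPow-*-≤ d Y (subst (ℕ._≤ n ℕ.* Y) (sym (sumOver-applyUpTo n (λ j → j) total))
                                                                   (serve-amortised π ρ ss e (costOpt h ρ′ σ opt))) ⟩
  ℕtoℚ Y                                     ∎
  where
  open ℚₚ.≤-Reasoning
  Y = 16 ℕ.* costOpt h ρ (e ∷ σ) (ss ∷ opt) ℕ.+ Φ π ρ
  ρ′ = applySwaps h ρ (offlineSwaps ss)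
  d = level (toℕ (nd π e))
  n = 2 ℕ.^ d
  π′ : ℕ → Config h
  π′ j = applySwaps h π (pdSwaps (toℕ (nd π e)) (levelNode d j))
  total : ℕ → ℕ
  total j = pushDownCost π ρ′ e j ℕ.+ (16 ℕ.* costOpt h ρ′ σ opt ℕ.+ potentialAfter π ρ′ e j)
  branch≤ : ∀ j → ℕtoℚ (pushDownCost π ρ′ e j) ℚ.+ expCostRP h (π′ j) σ ≤ ℕtoℚ (total j)
  branch≤ j = subst (ℕtoℚ (pushDownCost π ρ′ e j) ℚ.+ expCostRP h (π′ j) σ ≤_) (sym (ℕtoℚ-+ (pushDownCost π ρ′ e j) _))
    (ℚₚ.+-monoʳ-≤ (ℕtoℚ (pushDownCost π ρ′ e j)) (expCostRP≤16*costOpt+Φ h (π′ j) ρ′ σ opt))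

theorem2 : (h : ℕ) (π₀ : Config h) (σ : List (Fin (size h))) (opt : OfflineAlg {h} σ) →
    expCostRP h π₀ σ ≤ ((+ 16) / 1) * ℕtoℚ (costOpt h π₀ σ opt)
theorem2 h π₀ σ opt = subst (expCostRP h π₀ σ ≤_) no-initial-potential (expCostRP≤16*costOpt+Φ h π₀ π₀ σ opt)
  where
  no-initial-potential : ℕtoℚ (16 ℕ.* costOpt h π₀ σ opt ℕ.+ Φ π₀ π₀) ≡ ((+ 16) / 1) * ℕtoℚ (costOpt h π₀ σ opt)
  no-initial-potential = begin
    ℕtoℚ (16 ℕ.* costOpt h π₀ σ opt ℕ.+ Φ π₀ π₀)  ≡⟨ cong (λ z → ℕtoℚ (16 ℕ.* costOpt h π₀ σ opt ℕ.+ z)) (Φ-self π₀) ⟩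
    ℕtoℚ (16 ℕ.* costOpt h π₀ σ opt ℕ.+ 0)        ≡⟨ cong ℕtoℚ (ℕₚ.+-identityʳ (16 ℕ.* costOpt h π₀ σ opt)) ⟩
    ℕtoℚ (16 ℕ.* costOpt h π₀ σ opt)              ≡⟨ ℕtoℚ-* 16 (costOpt h π₀ σ opt) ⟩
    ((+ 16) / 1) * ℕtoℚ (costOpt h π₀ σ opt)      ∎
    where open ≡-Reasoning
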